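{- Let $\mathbb{D}$ be a Euclidean domain, let $S$ be a consistent instance of $\textsc{2-Lin}(\mathbb{D})$, let $G_S$ be its primal graph, and let $\mathcal{B}_S$ be the set of (edge sets of) identity cycles in $S$. Then $(G_S,\mathcal{B}_S)$ is a biased graph.
   Context: A Euclidean domain is an integral domain $\mathbb{D}$ with a function $f:D\to\mathbb{N}_0$, $f(0)=0$, such that for $b\ne0$ every $a$ can be written $a=bq+r$ with $f(r)<f(b)$. Equations are $ax+by=c$ ($a,b,c\in D$, $x\ne y$); by standing assumption in every equation $a,b$ are not both zero and co-prime. The primal graph has the variables as vertices and an edge $\{x,y\}$ for each equation over $x,y$. A path is a set of equations over distinct variables $p_1,\dots,p_\ell$ with one equation over each consecutive pair; a cycle is defined analogously cyclically. The equation implied by a path is obtained by successively eliminating intermediate variables: $ap_1+bp_2=c$, $a'p_2+b'p_3=c'$ are replaced by $(a'a)p_1-(b'b)p_3=a'c-bc'$. Equations are equivalent if they have the same satisfying assignments. A consistent cycle is an identity cycle if for every two of its variables $x,y$ the two $\{x,y\}$-paths in the cycle imply equivalent equations. A biased graph is a pair $(G,\mathcal{B})$ with $\mathcal{B}$ a set of cycles of $G$ such that whenever two cycles in $\mathcal{B}$ form a theta graph (three internally disjoint paths with common endpoints), the third cycle of their union is also in $\mathcal{B}$. -}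

module Defs where

open import Level using (Level; _⊔_; 0ℓ) renaming (suc to lsuc)
open import Algebra.Bundles using (CommutativeRing)
open import Data.Nat using (ℕ; _<_)
open import Data.Fin using (Fin; _≟_)
open import Data.List using (List; []; _∷_; _++_; zipWith)
open import Data.List.Membership.Propositional renaming (_∈_ to _∈L_)
open import Data.List.Relation.Unary.Unique.Propositional using (Unique)
open import Data.Product using (Σ; ∃; ∃₂; _×_; _,_)
open import Data.Sum using (_⊎_)
open import Relation.Nullary using (¬_; yes; no)
open import Relation.Unary using (Pred; _≐_; _∪_)
open import Relation.Binary.PropositionalEquality using (_≡_; _≢_)

record EuclideanDomain (c ℓ : Level) : Set (lsuc (c ⊔ ℓ)) where
  field
    commutativeRing : CommutativeRing c ℓ
  open CommutativeRing commutativeRing public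
  field
    1≉0            : ¬ (1# ≈ 0#)
    noZeroDivisors : ∀ x y → x * y ≈ 0# → (x ≈ 0#) ⊎ (y ≈ 0#)
    f        : Carrier → ℕ
    f-cong   : ∀ {x y} → x ≈ y → f x ≡ f y
    f-zero   : f 0# ≡ 0
    division : ∀ a b → ¬ (b ≈ 0#) →
               ∃₂ λ q r → (a ≈ b * q + r) × (f r < f b)

module _ {κ λ′} (D : EuclideanDomain κ λ′) where
  open EuclideanDomain D

  _∣_ : Carrier → Carrier → Set (κ ⊔ λ′)
  d ∣ a = ∃ λ k → a ≈ d * k

  IsUnit : Carrier → Set (κ ⊔ λ′)
  IsUnit u = ∃ λ v → u * v ≈ 1#

  Coprime : Carrier → Carrier → Set (κ ⊔ λ′)
  Coprime a b = ∀ d → d ∣ a → d ∣ b → IsUnit d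

  record Equation (n : ℕ) : Set κ where
    field
      a b c : Carrier
      x y   : Fin n
      x≢y   : x ≢ y

  open Equation public

  StandingAssumption : ∀ {n} → Equation n → Set (κ ⊔ λ′)
  StandingAssumption E = ¬ ((a E ≈ 0#) × (b E ≈ 0#)) × Coprime (a E) (b E)

  Satisfies : ∀ {n} → (Fin n → Carrier) → Equation n → Set λ′
  Satisfies σ E = a E * σ (x E) + b E * σ (y E) ≈ c E

  Consistent : ∀ {n m} → (Fin m → Equation n) → Set (κ ⊔ λ′)
  Consistent S = ∃ λ σ → ∀ e → Satisfies σ (S e)

  -- coefficient triple (a , b , c) of an equation  a·p + b·q = c
  -- in two designated (ordered) variables p, q
  record Triple : Set κ where
    constructor ⟨_,_,_⟩
    field
      ta tb tc : Carrier

  -- eliminating the middle variable: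
  -- a p₁ + b p₂ = c , a' p₂ + b' p₃ = c'  ↦  (a'a) p₁ − (b'b) p₃ = a'c − b c'
  combine : Triple → Triple → Triple
  combine ⟨ a₁ , b₁ , c₁ ⟩ ⟨ a₂ , b₂ , c₂ ⟩ =
    ⟨ a₂ * a₁ , - (b₂ * b₁) , a₂ * c₁ - b₁ * c₂ ⟩

  chain : Triple → List Triple → Triple
  chain t []       = t
  chain t (t' ∷ ts) = chain (combine t t') ts

  -- implied equation of a (non-empty) sequence of oriented equations;
  -- the [] case never arises for paths (they have at least one edge)
  implied : List Triple → Triple
  implied []       = ⟨ 0# , 0# , 0# ⟩
  implied (t ∷ ts) = chain t ts

  EquivEq : Triple → Triple → Set (κ ⊔ λ′)
  EquivEq ⟨ a₁ , b₁ , c₁ ⟩ ⟨ a₂ , b₂ , c₂ ⟩ =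
    ∀ p q → ((a₁ * p + b₁ * q ≈ c₁) → (a₂ * p + b₂ * q ≈ c₂))
          × ((a₂ * p + b₂ * q ≈ c₂) → (a₁ * p + b₁ * q ≈ c₁))

  -- The primal graph G_S: vertices Fin n, one edge e : Fin m per equation,
  -- joining the two variables of S e.  Edge sets are predicates on Fin m.

  module Graph {n m : ℕ} (S : Fin m → Equation n) where

    EdgeSet : Set₁
    EdgeSet = Pred (Fin m) 0ℓ

    Joins : Fin m → Fin n → Fin n → Set
    Joins e u v = (x (S e) ≡ u × y (S e) ≡ v) ⊎ (x (S e) ≡ v × y (S e) ≡ u)

    data Links : List (Fin n) → List (Fin m) → Set where
      end  : ∀ v → Links (v ∷ []) []
      step : ∀ {u v vs e es} → Joins e u v → Links (v ∷ vs) es →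
             Links (u ∷ v ∷ vs) (e ∷ es)

    record Path (u v : Fin n) : Set where
      field
        inner    : List (Fin n)
        edges    : List (Fin m)
        links    : Links (u ∷ inner ++ v ∷ []) edges
        distinct : Unique (u ∷ inner ++ v ∷ [])

    open Path public

    verts : ∀ {u v} → Path u v → List (Fin n)
    verts {u} {v} P = u ∷ inner P ++ v ∷ []

    E : ∀ {u v} → Path u v → EdgeSet
    E P e = e ∈L edges P

    record Cycle : Set where
      field
        start     : Fin n
        rest      : List (Fin n)
        cedges    : List (Fin m)
        clinks    : Links (start ∷ rest ++ start ∷ []) cedges
        cdistinct : Unique (start ∷ rest)
        edistinct : Unique cedges

    open Cycle public

    IsCycle : EdgeSet → Set
    IsCycle C = Σ Cycle λ Z → C ≐ (λ e → e ∈L cedges Z)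

    orient : Fin m → Fin n → Triple
    orient e u with x (S e) ≟ u
    ... | yes _ = ⟨ a (S e) , b (S e) , c (S e) ⟩
    ... | no  _ = ⟨ b (S e) , a (S e) , c (S e) ⟩

    impliedBy : ∀ {u v} → Path u v → Triple
    impliedBy P = implied (zipWith orient (edges P) (verts P))

    ConsistentSet : EdgeSet → Set (κ ⊔ λ′)
    ConsistentSet C = ∃ λ σ → ∀ e → C e → Satisfies σ (S e)

    IdentityCycle : EdgeSet → Set (κ ⊔ λ′)
    IdentityCycle C =
      IsCycle C × ConsistentSet C ×
      (∀ u v (P Q : Path u v) → (∀ e → E P e → C e) → (∀ e → E Q e → C e) →
         EquivEq (impliedBy P) (impliedBy Q))

    InternallyDisjoint : ∀ {u v} → Path u v → Path u v → Set
    InternallyDisjoint {u} {v} P Q =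
      (∀ w → w ∈L verts P → w ∈L verts Q → (w ≡ u) ⊎ (w ≡ v)) ×
      (∀ e → e ∈L edges P → e ∈L edges Q → Data.Empty.⊥)
      where import Data.Empty

    ThetaThird : EdgeSet → EdgeSet → EdgeSet → Set
    ThetaThird C₁ C₂ C₃ =
      Σ (Fin n) λ u → Σ (Fin n) λ v →
      Σ (Path u v) λ P₁ → Σ (Path u v) λ P₂ → Σ (Path u v) λ P₃ →
        InternallyDisjoint P₁ P₂ × InternallyDisjoint P₁ P₃ ×
        InternallyDisjoint P₂ P₃ ×
        (C₁ ≐ (E P₁ ∪ E P₂)) × (C₂ ≐ (E P₁ ∪ E P₃)) × (C₃ ≐ (E P₂ ∪ E P₃))

    IsBiasedGraph : ∀ {b} → Pred EdgeSet b → Set (lsuc 0ℓ ⊔ b)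
    IsBiasedGraph B =
      (∀ C → B C → IsCycle C) ×
      (∀ C₁ C₂ C₃ → B C₁ → B C₂ → ThetaThird C₁ C₂ C₃ → B C₃)

-- Fix a solution σ of S.  Every equation implied by a path is satisfied by σ, so two paths between the
-- same variables imply equivalent equations as soon as their coefficient vectors are proportional and one
-- of them is nondegenerate; proportionality in turn follows from a common nonzero homogeneous solution.
--
-- Let C₁ = P₁ ∪ P₂ and C₂ = P₁ ∪ P₃ be identity cycles forming a theta graph with C₃ = P₂ ∪ P₃.  Then P₂
-- and P₃ imply equations equivalent to that of P₁, hence proportional ones.  Along a path, products of edge
-- coefficients form a homogeneous solution of its edge equations; proportionality lets us rescale these
-- potentials for P₂ and P₃ so that they agree at the common endpoints, which gives two homogeneous solutions
-- on all of C₃.  Any two paths in C₃ then imply equations with the common solution σ and common homogeneous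
-- solutions, hence equivalent ones.  Degeneracy can only come from an edge with a zero coefficient, which an
-- identity cycle with at least three edges cannot contain: proportionality spreads it to zero coefficients
-- of both kinds, and the arc through them that avoids a third edge would imply 0 = 0, while that edge alone
-- implies a proper equation.  This leaves a theta graph of three parallel edges, where proportionality and
-- nondegeneracy of the single-edge equations settle the claim directly.

module Submission where

open import Algebra.Bundles using (CommutativeRing)
open import Data.Nat.Base using (ℕ)
open import Data.Fin using (Fin; _≟_)
open import Data.Product using (_,_; proj₁)
open import Defs

-- The reflection-free ring solver needs coefficients with decidable equality: use ℤ, which maps into every
-- commutative ring.
module RingSolver {c ℓ} (R : CommutativeRing c ℓ) where

  open import Data.Maybe using (Maybe; just; nothing)
  open import Data.Nat.Base as ℕ using (ℕ)
  import Data.Nat.Properties as ℕ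
  import Data.Integer.Base as ℤ
  import Data.Integer.Properties as ℤ
  open import Data.Sign.Base as Sign using (Sign)
  open import Relation.Binary.PropositionalEquality using (_≡_; cong)
  open import Relation.Nullary using (yes; no)
  import Algebra.Solver.Ring.AlmostCommutativeRing as ACR
  import Algebra.Solver.Ring

  open CommutativeRing R
  open import Algebra.Properties.Semiring.Mult semiring using (_×_; ×-homo-+; ×1-homo-*)
  open import Algebra.Properties.Ring ring using (-0#≈0#; -‿involutive; -‿+-comm; -1*x≈-x; -‿distribˡ-*; -‿distribʳ-*)
  open import Relation.Binary.Reasoning.Setoid setoid

  fromℕ : ℕ → Carrier
  fromℕ n = n × 1#

  fromℤ : ℤ.ℤ → Carrier
  fromℤ (ℤ.+ n)     = fromℕ n
  fromℤ ℤ.-[1+ n ]  = - fromℕ (ℕ.suc n)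

  fromSign : Sign → Carrier
  fromSign Sign.+ = 1#
  fromSign Sign.- = - 1#

  private
    [1+x]-[1+y]≈x-y : ∀ x y → (1# + x) - (1# + y) ≈ x - y
    [1+x]-[1+y]≈x-y x y = begin
      (1# + x) + - (1# + y)   ≈⟨ +-congˡ (-‿+-comm 1# y) ⟨
      (1# + x) + (- 1# + - y) ≈⟨ +-assoc 1# x (- 1# + - y) ⟩
      1# + (x + (- 1# + - y)) ≈⟨ +-congˡ (+-assoc x (- 1#) (- y)) ⟨
      1# + ((x + - 1#) + - y) ≈⟨ +-congˡ (+-congʳ (+-comm x (- 1#))) ⟩
      1# + ((- 1# + x) + - y) ≈⟨ +-congˡ (+-assoc (- 1#) x (- y)) ⟩
      1# + (- 1# + (x + - y)) ≈⟨ +-assoc 1# (- 1#) (x + - y) ⟨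
      (1# + - 1#) + (x + - y) ≈⟨ +-congʳ (-‿inverseʳ 1#) ⟩
      0# + (x + - y)          ≈⟨ +-identityˡ _ ⟩
      x - y                   ∎

    -x*-y≈x*y : ∀ x y → - x * - y ≈ x * y
    -x*-y≈x*y x y = begin
      - x * - y   ≈⟨ -‿distribˡ-* x (- y) ⟨
      - (x * - y) ≈⟨ -‿cong (-‿distribʳ-* x y) ⟨
      - - (x * y) ≈⟨ -‿involutive _ ⟩
      x * y       ∎

    [ab][cd]≈[ac][bd] : ∀ a b c d → (a * b) * (c * d) ≈ (a * c) * (b * d)
    [ab][cd]≈[ac][bd] a b c d = begin
      (a * b) * (c * d) ≈⟨ *-assoc a b (c * d) ⟩
      a * (b * (c * d)) ≈⟨ *-congˡ (*-assoc b c d) ⟨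
      a * ((b * c) * d) ≈⟨ *-congˡ (*-congʳ (*-comm b c)) ⟩
      a * ((c * b) * d) ≈⟨ *-congˡ (*-assoc c b d) ⟩
      a * (c * (b * d)) ≈⟨ *-assoc a c (b * d) ⟨
      (a * c) * (b * d) ∎

  fromℤ-⊖ : ∀ m n → fromℤ (m ℤ.⊖ n) ≈ fromℕ m - fromℕ n
  fromℤ-⊖ ℕ.zero    ℕ.zero    = sym (-‿inverseʳ 0#)
  fromℤ-⊖ ℕ.zero    (ℕ.suc n) = sym (+-identityˡ _)
  fromℤ-⊖ (ℕ.suc m) ℕ.zero    = sym (trans (+-congˡ -0#≈0#) (+-identityʳ _))
  fromℤ-⊖ (ℕ.suc m) (ℕ.suc n) = begin
    fromℤ (ℕ.suc m ℤ.⊖ ℕ.suc n)     ≡⟨ cong fromℤ (ℤ.[1+m]⊖[1+n]≡m⊖n m n) ⟩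
    fromℤ (m ℤ.⊖ n)                 ≈⟨ fromℤ-⊖ m n ⟩
    fromℕ m - fromℕ n               ≈⟨ [1+x]-[1+y]≈x-y (fromℕ m) (fromℕ n) ⟨
    fromℕ (ℕ.suc m) - fromℕ (ℕ.suc n) ∎

  fromℤ-+ : ∀ i j → fromℤ (i ℤ.+ j) ≈ fromℤ i + fromℤ j
  fromℤ-+ (ℤ.+ m)    (ℤ.+ n)    = ×-homo-+ 1# m n
  fromℤ-+ (ℤ.+ m)    ℤ.-[1+ n ] = fromℤ-⊖ m (ℕ.suc n)
  fromℤ-+ ℤ.-[1+ m ] (ℤ.+ n)    = trans (fromℤ-⊖ n (ℕ.suc m)) (+-comm _ _)
  fromℤ-+ ℤ.-[1+ m ] ℤ.-[1+ n ] = begin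
    - fromℕ (ℕ.suc (ℕ.suc (m ℕ.+ n)))       ≡⟨ cong (λ k → - fromℕ (ℕ.suc k)) (ℕ.+-suc m n) ⟨
    - fromℕ (ℕ.suc m ℕ.+ ℕ.suc n)           ≈⟨ -‿cong (×-homo-+ 1# (ℕ.suc m) (ℕ.suc n)) ⟩
    - (fromℕ (ℕ.suc m) + fromℕ (ℕ.suc n))   ≈⟨ -‿+-comm _ _ ⟨
    - fromℕ (ℕ.suc m) + - fromℕ (ℕ.suc n)   ∎

  fromℤ-neg : ∀ i → fromℤ (ℤ.- i) ≈ - fromℤ i
  fromℤ-neg (ℤ.+ ℕ.zero)    = sym -0#≈0#
  fromℤ-neg (ℤ.+ ℕ.suc n)   = refl
  fromℤ-neg ℤ.-[1+ n ]      = sym (-‿involutive _)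

  fromℤ-◃ : ∀ s n → fromℤ (s ℤ.◃ n) ≈ fromSign s * fromℕ n
  fromℤ-◃ s      ℕ.zero    = sym (zeroʳ _)
  fromℤ-◃ Sign.+ (ℕ.suc n) = sym (*-identityˡ _)
  fromℤ-◃ Sign.- (ℕ.suc n) = sym (-1*x≈-x _)

  fromℤ≈sign*abs : ∀ i → fromℤ i ≈ fromSign (ℤ.sign i) * fromℕ ℤ.∣ i ∣
  fromℤ≈sign*abs (ℤ.+ n)    = sym (*-identityˡ _)
  fromℤ≈sign*abs ℤ.-[1+ n ] = sym (-1*x≈-x _)

  fromSign-* : ∀ s t → fromSign (s Sign.* t) ≈ fromSign s * fromSign t
  fromSign-* Sign.+ Sign.+ = sym (*-identityˡ _)
  fromSign-* Sign.+ Sign.- = sym (*-identityˡ _)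
  fromSign-* Sign.- Sign.+ = sym (*-identityʳ _)
  fromSign-* Sign.- Sign.- = sym (trans (-x*-y≈x*y 1# 1#) (*-identityˡ _))

  fromℤ-* : ∀ i j → fromℤ (i ℤ.* j) ≈ fromℤ i * fromℤ j
  fromℤ-* i j = begin
    fromℤ ((ℤ.sign i Sign.* ℤ.sign j) ℤ.◃ (ℤ.∣ i ∣ ℕ.* ℤ.∣ j ∣))
      ≈⟨ fromℤ-◃ (ℤ.sign i Sign.* ℤ.sign j) (ℤ.∣ i ∣ ℕ.* ℤ.∣ j ∣) ⟩
    fromSign (ℤ.sign i Sign.* ℤ.sign j) * fromℕ (ℤ.∣ i ∣ ℕ.* ℤ.∣ j ∣)
      ≈⟨ *-cong (fromSign-* (ℤ.sign i) (ℤ.sign j)) (×1-homo-* ℤ.∣ i ∣ ℤ.∣ j ∣) ⟩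
    (fromSign (ℤ.sign i) * fromSign (ℤ.sign j)) * (fromℕ ℤ.∣ i ∣ * fromℕ ℤ.∣ j ∣)
      ≈⟨ [ab][cd]≈[ac][bd] _ _ _ _ ⟩
    (fromSign (ℤ.sign i) * fromℕ ℤ.∣ i ∣) * (fromSign (ℤ.sign j) * fromℕ ℤ.∣ j ∣)
      ≈⟨ *-cong (fromℤ≈sign*abs i) (fromℤ≈sign*abs j) ⟨
    fromℤ i * fromℤ j ∎

  fromℤ-homomorphism : ℤ.+-*-rawRing ACR.-Raw-AlmostCommutative⟶ ACR.fromCommutativeRing R
  fromℤ-homomorphism = record
    { ⟦_⟧    = fromℤ
    ; +-homo = fromℤ-+
    ; *-homo = fromℤ-*
    ; -‿homo = fromℤ-neg
    ; 0-homo = refl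
    ; 1-homo = +-identityʳ 1#
    }

  fromℤ-≟ : ∀ i j → Maybe (fromℤ i ≈ fromℤ j)
  fromℤ-≟ i j with i ℤ.≟ j
  ... | yes _≡_.refl = just refl
  ... | no _         = nothing

  open Algebra.Solver.Ring ℤ.+-*-rawRing (ACR.fromCommutativeRing R) fromℤ-homomorphism fromℤ-≟ public
    using (solve; _:=_; _:+_; _:*_; :-_; _:-_; con)

module LinearEquations {κ λ′} (D : EuclideanDomain κ λ′) where

  open import Data.List using (List; []; _∷_; map)
  open import Data.List.Relation.Unary.Any using (Any; here; there)
  import Data.List.Relation.Unary.Any.Properties as Any
  open import Data.Product using (_×_; _,_)
  open import Data.Sum using (_⊎_; inj₁; inj₂; [_,_]′)
  open import Data.Empty using (⊥; ⊥-elim)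
  open import Relation.Nullary using (¬_)
  import Data.Integer.Base as ℤ
  open import Level using (_⊔_)
  open import Relation.Binary.PropositionalEquality as ≡ using (_≢_)

  open EuclideanDomain D
  open import Algebra.Properties.Ring ring using (-0#≈0#; -‿involutive; x∙y⁻¹≈ε⇒x≈y)
  open import Relation.Binary.Reasoning.Setoid setoid
  open RingSolver commutativeRing
  open Triple public

  x≈0⇒x*y≈0 : ∀ {x} y → x ≈ 0# → x * y ≈ 0#
  x≈0⇒x*y≈0 y x≈0 = trans (*-congʳ x≈0) (zeroˡ y)

  y≈0⇒x*y≈0 : ∀ x {y} → y ≈ 0# → x * y ≈ 0#
  y≈0⇒x*y≈0 x y≈0 = trans (*-congˡ y≈0) (zeroʳ x)

  -x≈0⇒x≈0 : ∀ {x} → - x ≈ 0# → x ≈ 0#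
  -x≈0⇒x≈0 {x} -x≈0 = trans (sym (-‿involutive x)) (trans (-‿cong -x≈0) -0#≈0#)

  x≈0⇒-x≈0 : ∀ {x} → x ≈ 0# → - x ≈ 0#
  x≈0⇒-x≈0 x≈0 = trans (-‿cong x≈0) -0#≈0#

  x*y≈0∧y≉0⇒x≈0 : ∀ {x y} → x * y ≈ 0# → ¬ y ≈ 0# → x ≈ 0#
  x*y≈0∧y≉0⇒x≈0 xy≈0 y≉0 = [ (λ x≈0 → x≈0) , (λ y≈0 → ⊥-elim (y≉0 y≈0)) ]′ (noZeroDivisors _ _ xy≈0)

  product : List Carrier → Carrier
  product []       = 1#
  product (x ∷ xs) = x * product xs

  product≈0⇒any≈0 : ∀ xs → product xs ≈ 0# → Any (_≈ 0#) xs
  product≈0⇒any≈0 []       1≈0 = ⊥-elim (1≉0 1≈0)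
  product≈0⇒any≈0 (x ∷ xs) p≈0 =
    [ here , (λ ∏≈0 → there (product≈0⇒any≈0 xs ∏≈0)) ]′ (noZeroDivisors _ _ p≈0)

  any≈0⇒product≈0 : ∀ {xs} → Any (_≈ 0#) xs → product xs ≈ 0#
  any≈0⇒product≈0 {x ∷ xs} (here x≈0)  = x≈0⇒x*y≈0 (product xs) x≈0
  any≈0⇒product≈0 {x ∷ xs} (there any) = y≈0⇒x*y≈0 x (any≈0⇒product≈0 any)

  alternatingSign : ∀ {a} {A : Set a} → List A → Carrier
  alternatingSign []       = 1#
  alternatingSign (_ ∷ xs) = - alternatingSign xs

  alternatingSign² : ∀ {a} {A : Set a} (xs : List A) → alternatingSign xs * alternatingSign xs ≈ 1#
  alternatingSign² []       = *-identityˡ 1#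
  alternatingSign² (_ ∷ xs) = trans (-x*-x≈x*x (alternatingSign xs)) (alternatingSign² xs)
    where
    -x*-x≈x*x : ∀ x → - x * - x ≈ x * x
    -x*-x≈x*x = solve 1 (λ x → (:- x) :* (:- x) := x :* x) refl

  Solves : Triple D → Carrier → Carrier → Set λ′
  Solves t p q = ta t * p + tb t * q ≈ tc t

  Annihilates : Triple D → Carrier → Carrier → Set λ′
  Annihilates t x y = ta t * x + tb t * y ≈ 0#

  Degenerate : Triple D → Set λ′
  Degenerate t = (ta t ≈ 0#) × (tb t ≈ 0#)

  Parallel : Triple D → Triple D → Set λ′
  Parallel t t' = ta t * tb t' ≈ ta t' * tb t

  infix 4 _⇛_
  _⇛_ : Triple D → Triple D → Set (κ ⊔ λ′)
  t ⇛ t' = ∀ p q → Solves t p q → Solves t' p q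

  solves-shift : ∀ {t p₀ q₀ x y} → Solves t p₀ q₀ → Annihilates t x y → Solves t (p₀ + x) (q₀ + y)
  solves-shift {t} {p₀} {q₀} {x} {y} s h = begin
    ta t * (p₀ + x) + tb t * (q₀ + y)         ≈⟨ distribute (ta t) (tb t) p₀ q₀ x y ⟩
    (ta t * p₀ + tb t * q₀) + (ta t * x + tb t * y) ≈⟨ +-cong s h ⟩
    tc t + 0#                                 ≈⟨ +-identityʳ (tc t) ⟩
    tc t                                      ∎
    where
    distribute : ∀ a b p q x y → a * (p + x) + b * (q + y) ≈ (a * p + b * q) + (a * x + b * y)
    distribute = solve 6 (λ a b p q x y → a :* (p :+ x) :+ b :* (q :+ y) := (a :* p :+ b :* q) :+ (a :* x :+ b :* y)) refl

  solves-difference : ∀ {t p₀ q₀ x y} → Solves t p₀ q₀ → Solves t (p₀ + x) (q₀ + y) → Annihilates t x y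
  solves-difference {t} {p₀} {q₀} {x} {y} s s' = begin
    ta t * x + tb t * y ≈⟨ difference (ta t) (tb t) p₀ q₀ x y ⟩
    (ta t * (p₀ + x) + tb t * (q₀ + y)) - (ta t * p₀ + tb t * q₀) ≈⟨ +-cong s' (-‿cong s) ⟩
    tc t - tc t         ≈⟨ -‿inverseʳ (tc t) ⟩
    0#                  ∎
    where
    difference : ∀ a b p q x y → a * x + b * y ≈ (a * (p + x) + b * (q + y)) - (a * p + b * q)
    difference = solve 6 (λ a b p q x y → a :* x :+ b :* y := (a :* (p :+ x) :+ b :* (q :+ y)) :- (a :* p :+ b :* q)) refl

  ⇛-annihilates : ∀ {t t' p₀ q₀ x y} → Solves t p₀ q₀ → Solves t' p₀ q₀ → t ⇛ t' →
                  Annihilates t x y → Annihilates t' x y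
  ⇛-annihilates s s' t⇛t' h = solves-difference s' (t⇛t' _ _ (solves-shift s h))

  ⇛⇒Parallel : ∀ {t t' p₀ q₀} → Solves t p₀ q₀ → Solves t' p₀ q₀ → t ⇛ t' → Parallel t t'
  ⇛⇒Parallel {t} {t'} s s' t⇛t' =
    x∙y⁻¹≈ε⇒x≈y _ _ (trans (cross (ta t) (tb t) (ta t') (tb t')) (x≈0⇒-x≈0 (⇛-annihilates s s' t⇛t' own)))
    where
    own : Annihilates t (tb t) (- ta t)
    own = solve 2 (λ a b → a :* b :+ b :* (:- a) := con (ℤ.+ 0)) refl (ta t) (tb t)
    cross : ∀ a b a' b' → a * b' - a' * b ≈ - (a' * b + b' * - a)
    cross = solve 4 (λ a b a' b' → a :* b' :- a' :* b := :- (a' :* b :+ b' :* (:- a))) refl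

  ⇛-preserves-Degenerate : ∀ {t t' p₀ q₀} → Solves t p₀ q₀ → Solves t' p₀ q₀ → t ⇛ t' →
                           Degenerate t → Degenerate t'
  ⇛-preserves-Degenerate {t} {t'} s s' t⇛t' (a≈0 , b≈0) =
    coefficient (⇛-annihilates s s' t⇛t' (annihilatesAll 1# 0#)) (*-identityʳ _) (zeroʳ _) ,
    coefficient (trans (+-comm _ _) (⇛-annihilates s s' t⇛t' (annihilatesAll 0# 1#))) (*-identityʳ _) (zeroʳ _)
    where
    annihilatesAll : ∀ x y → Annihilates t x y
    annihilatesAll x y = trans (+-cong (x≈0⇒x*y≈0 x a≈0) (x≈0⇒x*y≈0 y b≈0)) (+-identityˡ 0#)
    coefficient : ∀ {u v w} → u + v ≈ 0# → u ≈ w → v ≈ 0# → w ≈ 0#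
    coefficient u+v≈0 u≈w v≈0 = trans (sym u≈w) (trans (sym (+-identityʳ _)) (trans (+-congˡ (sym v≈0)) u+v≈0))

  det : Triple D → Triple D → Carrier
  det t t' = ta t * tb t' - ta t' * tb t

  det≈0⇒Parallel : ∀ {t t'} → det t t' ≈ 0# → Parallel t t'
  det≈0⇒Parallel {t} {t'} = x∙y⁻¹≈ε⇒x≈y (ta t * tb t') (ta t' * tb t)

  annihilates-both⇒x*det≈0 : ∀ {t t' x y} → Annihilates t x y → Annihilates t' x y → x * det t t' ≈ 0#
  annihilates-both⇒x*det≈0 {t} {t'} {x} {y} h h' = begin
    x * det t t'
      ≈⟨ expand (ta t) (tb t) (ta t') (tb t') x y ⟩
    tb t' * (ta t * x + tb t * y) - tb t * (ta t' * x + tb t' * y)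
      ≈⟨ +-cong (y≈0⇒x*y≈0 _ h) (x≈0⇒-x≈0 (y≈0⇒x*y≈0 _ h')) ⟩
    0# + 0#
      ≈⟨ +-identityˡ 0# ⟩
    0# ∎
    where
    expand : ∀ a b a' b' x y → x * (a * b' - a' * b) ≈ b' * (a * x + b * y) - b * (a' * x + b' * y)
    expand = solve 6 (λ a b a' b' x y →
      x :* (a :* b' :- a' :* b) := b' :* (a :* x :+ b :* y) :- b :* (a' :* x :+ b' :* y)) refl

  annihilates-both⇒y*det≈0 : ∀ {t t' x y} → Annihilates t x y → Annihilates t' x y → y * det t t' ≈ 0#
  annihilates-both⇒y*det≈0 {t} {t'} {x} {y} h h' = begin
    y * det t t'
      ≈⟨ expand (ta t) (tb t) (ta t') (tb t') x y ⟩
    ta t * (ta t' * x + tb t' * y) - ta t' * (ta t * x + tb t * y)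
      ≈⟨ +-cong (y≈0⇒x*y≈0 _ h') (x≈0⇒-x≈0 (y≈0⇒x*y≈0 _ h)) ⟩
    0# + 0#
      ≈⟨ +-identityˡ 0# ⟩
    0# ∎
    where
    expand : ∀ a b a' b' x y → y * (a * b' - a' * b) ≈ a * (a' * x + b' * y) - a' * (a * x + b * y)
    expand = solve 6 (λ a b a' b' x y →
      y :* (a :* b' :- a' :* b) := a :* (a' :* x :+ b' :* y) :- a' :* (a :* x :+ b :* y)) refl

  annihilates-both⇒Parallel : ∀ {t t' x y} → Annihilates t x y → Annihilates t' x y →
                              (x ≈ 0# × y ≈ 0#) ⊎ Parallel t t'
  annihilates-both⇒Parallel {t} {t'} {x} {y} h h' =
    [ (λ x≈0 → [ (λ y≈0 → inj₁ (x≈0 , y≈0)) , parallel ]′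
                 (noZeroDivisors y (det t t') (annihilates-both⇒y*det≈0 {t} {t'} h h')))
    , parallel
    ]′ (noZeroDivisors x (det t t') (annihilates-both⇒x*det≈0 {t} {t'} h h'))
    where
    parallel : det t t' ≈ 0# → (x ≈ 0# × y ≈ 0#) ⊎ Parallel t t'
    parallel det≈0 = inj₂ (det≈0⇒Parallel {t} {t'} det≈0)

  Parallel⇒⇛ : ∀ {t t' p₀ q₀} → Solves t p₀ q₀ → Solves t' p₀ q₀ → Parallel t t' → ¬ Degenerate t → t ⇛ t'
  Parallel⇒⇛ {t} {t'} {p₀} {q₀} s s' par nondeg p q s-pq =
    x∙y⁻¹≈ε⇒x≈y _ _
      ([ (λ a≈0 → [ (λ b≈0 → ⊥-elim (nondeg (a≈0 , b≈0))) , (λ Δ≈0 → Δ≈0) ]′ (noZeroDivisors _ _ bΔ≈0))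
       , (λ Δ≈0 → Δ≈0)
       ]′ (noZeroDivisors _ _ aΔ≈0))
    where
    d≈0 : det t t' ≈ 0#
    d≈0 = trans (+-congʳ par) (-‿inverseʳ _)
    shift≈0 : (ta t * p + tb t * q) - (ta t * p₀ + tb t * q₀) ≈ 0#
    shift≈0 = trans (+-cong s-pq (-‿cong s)) (-‿inverseʳ _)
    Δ = (ta t' * p + tb t' * q) - tc t'
    aΔ≈0 : ta t * Δ ≈ 0#
    aΔ≈0 = begin
      ta t * ((ta t' * p + tb t' * q) - tc t')
        ≈⟨ *-congˡ (+-congˡ (-‿cong (sym s'))) ⟩
      ta t * ((ta t' * p + tb t' * q) - (ta t' * p₀ + tb t' * q₀))
        ≈⟨ expand (ta t) (tb t) (ta t') (tb t') p q p₀ q₀ ⟩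
      ta t' * ((ta t * p + tb t * q) - (ta t * p₀ + tb t * q₀)) + det t t' * (q - q₀)
        ≈⟨ +-cong (y≈0⇒x*y≈0 _ shift≈0) (x≈0⇒x*y≈0 _ d≈0) ⟩
      0# + 0#
        ≈⟨ +-identityˡ 0# ⟩
      0# ∎
      where
      expand : ∀ a b a' b' p q p₀ q₀ →
               a * ((a' * p + b' * q) - (a' * p₀ + b' * q₀)) ≈
               a' * ((a * p + b * q) - (a * p₀ + b * q₀)) + (a * b' - a' * b) * (q - q₀)
      expand = solve 8 (λ a b a' b' p q p₀ q₀ →
        a :* ((a' :* p :+ b' :* q) :- (a' :* p₀ :+ b' :* q₀)) :=
        a' :* ((a :* p :+ b :* q) :- (a :* p₀ :+ b :* q₀)) :+ (a :* b' :- a' :* b) :* (q :- q₀)) refl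
    bΔ≈0 : tb t * Δ ≈ 0#
    bΔ≈0 = begin
      tb t * ((ta t' * p + tb t' * q) - tc t')
        ≈⟨ *-congˡ (+-congˡ (-‿cong (sym s'))) ⟩
      tb t * ((ta t' * p + tb t' * q) - (ta t' * p₀ + tb t' * q₀))
        ≈⟨ expand (ta t) (tb t) (ta t') (tb t') p q p₀ q₀ ⟩
      tb t' * ((ta t * p + tb t * q) - (ta t * p₀ + tb t * q₀)) - det t t' * (p - p₀)
        ≈⟨ +-cong (y≈0⇒x*y≈0 _ shift≈0) (x≈0⇒-x≈0 (x≈0⇒x*y≈0 _ d≈0)) ⟩
      0# + 0#
        ≈⟨ +-identityˡ 0# ⟩
      0# ∎
      where
      expand : ∀ a b a' b' p q p₀ q₀ →
               b * ((a' * p + b' * q) - (a' * p₀ + b' * q₀)) ≈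
               b' * ((a * p + b * q) - (a * p₀ + b * q₀)) - (a * b' - a' * b) * (p - p₀)
      expand = solve 8 (λ a b a' b' p q p₀ q₀ →
        b :* ((a' :* p :+ b' :* q) :- (a' :* p₀ :+ b' :* q₀)) :=
        b' :* ((a :* p :+ b :* q) :- (a :* p₀ :+ b :* q₀)) :- (a :* b' :- a' :* b) :* (p :- p₀)) refl

  common-solutions⇒⇛ : ∀ {t t' p₀ q₀ x y x' y'} → Solves t p₀ q₀ → Solves t' p₀ q₀ →
                       Annihilates t x y → Annihilates t' x y → Annihilates t x' y' → Annihilates t' x' y' →
                       ¬ (x ≈ 0# × y ≈ 0# × x' ≈ 0# × y' ≈ 0#) → ¬ Degenerate t → t ⇛ t'
  common-solutions⇒⇛ {t} {t'} s s' h h' k k' nonzero nondeg =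
    [ (λ (x≈0 , y≈0) → [ (λ (x'≈0 , y'≈0) → ⊥-elim (nonzero (x≈0 , y≈0 , x'≈0 , y'≈0))) , from-parallel ]′
                          (annihilates-both⇒Parallel {t} {t'} k k'))
    , from-parallel ]′ (annihilates-both⇒Parallel {t} {t'} h h')
    where
    from-parallel : Parallel t t' → t ⇛ t'
    from-parallel par = Parallel⇒⇛ {t} {t'} s s' par nondeg

  combine-lhs : ∀ t t' p q r → ta (combine D t t') * p + tb (combine D t t') * r ≈
                               ta t' * (ta t * p + tb t * q) - tb t * (ta t' * q + tb t' * r)
  combine-lhs t t' = eliminate (ta t) (tb t) (ta t') (tb t')
    where
    eliminate : ∀ a b a' b' p q r → (a' * a) * p + (- (b' * b)) * r ≈ a' * (a * p + b * q) - b * (a' * q + b' * r)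
    eliminate = solve 7 (λ a b a' b' p q r →
      (a' :* a) :* p :+ (:- (b' :* b)) :* r := a' :* (a :* p :+ b :* q) :- b :* (a' :* q :+ b' :* r)) refl

  combine-solves : ∀ {t t' p q r} → Solves t p q → Solves t' q r → Solves (combine D t t') p r
  combine-solves {t} {t'} {p} {q} {r} s s' =
    trans (combine-lhs t t' p q r) (+-cong (*-congˡ s) (-‿cong (*-congˡ s')))

  combine-annihilates : ∀ {t t' x y z} → Annihilates t x y → Annihilates t' y z → Annihilates (combine D t t') x z
  combine-annihilates {t} {t'} {x} {y} {z} h h' = begin
    ta (combine D t t') * x + tb (combine D t t') * z           ≈⟨ combine-lhs t t' x y z ⟩
    ta t' * (ta t * x + tb t * y) - tb t * (ta t' * y + tb t' * z)
      ≈⟨ +-cong (y≈0⇒x*y≈0 _ h) (x≈0⇒-x≈0 (y≈0⇒x*y≈0 _ h')) ⟩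
    0# + 0#                                                     ≈⟨ +-identityˡ 0# ⟩
    0#                                                          ∎

  ta-chain : ∀ t ts → ta (chain D t ts) ≈ product (map ta ts) * ta t
  ta-chain t []        = sym (*-identityˡ (ta t))
  ta-chain t (t' ∷ ts) = begin
    ta (chain D (combine D t t') ts)           ≈⟨ ta-chain (combine D t t') ts ⟩
    product (map ta ts) * (ta t' * ta t)       ≈⟨ reassociate (product (map ta ts)) (ta t') (ta t) ⟩
    (ta t' * product (map ta ts)) * ta t       ∎
    where
    reassociate : ∀ p a a' → p * (a * a') ≈ (a * p) * a'
    reassociate = solve 3 (λ p a a' → p :* (a :* a') := (a :* p) :* a') refl

  tb-chain : ∀ t ts → tb (chain D t ts) ≈ (alternatingSign ts * product (map tb ts)) * tb t
  tb-chain t []        = sym (trans (*-congʳ (*-identityˡ 1#)) (*-identityˡ (tb t)))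
  tb-chain t (t' ∷ ts) = begin
    tb (chain D (combine D t t') ts)                                    ≈⟨ tb-chain (combine D t t') ts ⟩
    (alternatingSign ts * product (map tb ts)) * (- (tb t' * tb t))
      ≈⟨ reassociate (alternatingSign ts) (product (map tb ts)) (tb t') (tb t) ⟩
    (- alternatingSign ts * (tb t' * product (map tb ts))) * tb t       ∎
    where
    reassociate : ∀ s p b b' → (s * p) * (- (b * b')) ≈ (- s * (b * p)) * b'
    reassociate = solve 4 (λ s p b b' → (s :* p) :* (:- (b :* b')) := (:- s :* (b :* p)) :* b') refl

  ta-implied : ∀ ts → ts ≢ [] → ta (implied D ts) ≈ product (map ta ts)
  ta-implied []       ts≢[] = ⊥-elim (ts≢[] ≡.refl)
  ta-implied (t ∷ ts) _     = trans (ta-chain t ts) (*-comm _ _)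

  tb-implied : ∀ ts → ts ≢ [] → tb (implied D ts) ≈ - (alternatingSign ts * product (map tb ts))
  tb-implied []       ts≢[] = ⊥-elim (ts≢[] ≡.refl)
  tb-implied (t ∷ ts) _     = trans (tb-chain t ts) (reassociate (alternatingSign ts) (product (map tb ts)) (tb t))
    where
    reassociate : ∀ s p b → (s * p) * b ≈ - (- s * (b * p))
    reassociate = solve 3 (λ s p b → (s :* p) :* b := :- (:- s :* (b :* p))) refl

  alternatingSign≉0 : ∀ {a} {A : Set a} (xs : List A) → ¬ alternatingSign xs ≈ 0#
  alternatingSign≉0 xs s≈0 = 1≉0 (trans (sym (alternatingSign² xs)) (x≈0⇒x*y≈0 _ s≈0))

  ta-implied≈0⇒any : ∀ ts → ts ≢ [] → ta (implied D ts) ≈ 0# → Any (λ t → ta t ≈ 0#) ts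
  ta-implied≈0⇒any ts ts≢[] a≈0 =
    Any.map⁻ {f = ta} {P = _≈ 0#} (product≈0⇒any≈0 (map ta ts) (trans (sym (ta-implied ts ts≢[])) a≈0))

  tb-implied≈0⇒any : ∀ ts → ts ≢ [] → tb (implied D ts) ≈ 0# → Any (λ t → tb t ≈ 0#) ts
  tb-implied≈0⇒any ts ts≢[] b≈0 = Any.map⁻ {f = tb} {P = _≈ 0#} (product≈0⇒any≈0 (map tb ts)
    (x*y≈0∧y≉0⇒x≈0 (trans (*-comm _ _) (-x≈0⇒x≈0 (trans (sym (tb-implied ts ts≢[])) b≈0))) (alternatingSign≉0 ts)))

  any⇒ta-implied≈0 : ∀ {ts} → Any (λ t → ta t ≈ 0#) ts → ta (implied D ts) ≈ 0#
  any⇒ta-implied≈0 {t ∷ ts} any =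
    trans (ta-implied (t ∷ ts) (λ ())) (any≈0⇒product≈0 (Any.map⁺ {f = ta} {P = _≈ 0#} any))

  any⇒tb-implied≈0 : ∀ {ts} → Any (λ t → tb t ≈ 0#) ts → tb (implied D ts) ≈ 0#
  any⇒tb-implied≈0 {t ∷ ts} any =
    trans (tb-implied (t ∷ ts) (λ ()))
      (x≈0⇒-x≈0 (y≈0⇒x*y≈0 (alternatingSign (t ∷ ts)) (any≈0⇒product≈0 (Any.map⁺ {f = tb} {P = _≈ 0#} any))))

  Annihilates-scale : ∀ {t x y} k → Annihilates t x y → Annihilates t (k * x) (k * y)
  Annihilates-scale {t} {x} {y} k h = begin
    ta t * (k * x) + tb t * (k * y) ≈⟨ factor (ta t) (tb t) k x y ⟩
    k * (ta t * x + tb t * y)       ≈⟨ y≈0⇒x*y≈0 k h ⟩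
    0#                              ∎
    where
    factor : ∀ a b k x y → a * (k * x) + b * (k * y) ≈ k * (a * x + b * y)
    factor = solve 5 (λ a b k x y → a :* (k :* x) :+ b :* (k :* y) := k :* (a :* x :+ b :* y)) refl

  Annihilates-cong : ∀ {t x y x' y'} → x ≈ x' → y ≈ y' → Annihilates t x y → Annihilates t x' y'
  Annihilates-cong x≈x' y≈y' h = trans (+-cong (*-congˡ (sym x≈x')) (*-congˡ (sym y≈y'))) h

  Parallel⇒ta≈0 : ∀ {t t'} → Parallel t t' → ¬ Degenerate t' → ta t' ≈ 0# → ta t ≈ 0#
  Parallel⇒ta≈0 {t} {t'} par nondeg a'≈0 =
    x*y≈0∧y≉0⇒x≈0 (trans par (x≈0⇒x*y≈0 (tb t) a'≈0)) (λ b'≈0 → nondeg (a'≈0 , b'≈0))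

  Parallel⇒tb≈0 : ∀ {t t'} → Parallel t t' → ¬ Degenerate t' → tb t' ≈ 0# → tb t ≈ 0#
  Parallel⇒tb≈0 {t} {t'} par nondeg b'≈0 =
    x*y≈0∧y≉0⇒x≈0 (trans (*-comm _ _) (trans (sym par) (y≈0⇒x*y≈0 (ta t) b'≈0))) (λ a'≈0 → nondeg (a'≈0 , b'≈0))

  Parallel-zeros⇒⊥ : ∀ {t t'} → Parallel t t' → ¬ Degenerate t → ¬ Degenerate t' →
                     tb t ≈ 0# ⊎ tb t' ≈ 0# → ta t ≈ 0# ⊎ ta t' ≈ 0# → ⊥
  Parallel-zeros⇒⊥ par nondeg nondeg' (inj₁ b≈0)  (inj₁ a≈0)  = nondeg (a≈0 , b≈0)
  Parallel-zeros⇒⊥ par nondeg nondeg' (inj₂ b'≈0) (inj₂ a'≈0) = nondeg' (a'≈0 , b'≈0)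
  Parallel-zeros⇒⊥ {t} {t'} par nondeg nondeg' (inj₁ b≈0)  (inj₂ a'≈0) =
    nondeg (Parallel⇒ta≈0 {t} {t'} par nondeg' a'≈0 , b≈0)
  Parallel-zeros⇒⊥ {t} {t'} par nondeg nondeg' (inj₂ b'≈0) (inj₁ a≈0)  =
    nondeg' (Parallel⇒ta≈0 {t'} {t} (sym par) nondeg a≈0 , b'≈0)

  x≈-[s*y]⇒y≈-[s*x] : ∀ {s x y} → s * s ≈ 1# → x ≈ - (s * y) → y ≈ - (s * x)
  x≈-[s*y]⇒y≈-[s*x] {s} {x} {y} s²≈1 x≈-sy = begin
    y                   ≈⟨ *-identityˡ y ⟨
    1# * y              ≈⟨ *-congʳ s²≈1 ⟨
    (s * s) * y         ≈⟨ cancel s y ⟩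
    - (s * - (s * y))   ≈⟨ -‿cong (*-congˡ x≈-sy) ⟨
    - (s * x)           ∎
    where
    cancel : ∀ s y → (s * s) * y ≈ - (s * - (s * y))
    cancel = solve 2 (λ s y → (s :* s) :* y := :- (s :* (:- (s :* y)))) refl

  x≈s*y⇒y≈s*x : ∀ {s x y} → s * s ≈ 1# → x ≈ s * y → y ≈ s * x
  x≈s*y⇒y≈s*x {s} {x} {y} s²≈1 x≈sy = begin
    y             ≈⟨ *-identityˡ y ⟨
    1# * y        ≈⟨ *-congʳ s²≈1 ⟨
    (s * s) * y   ≈⟨ *-assoc s s y ⟩
    s * (s * y)   ≈⟨ *-congˡ x≈sy ⟨
    s * x         ∎

module Walks {κ λ′} (D : EuclideanDomain κ λ′) {n m : ℕ} (S : Fin m → Equation D n) where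

  open import Data.List using (List; []; _∷_; _++_; _ʳ++_)
  open import Data.List.Membership.Propositional using (_∈_; _∉_)
  open import Data.List.Membership.Propositional.Properties using (∈-++⁺ˡ; ∈-++⁺ʳ; ∈-++⁻; ∈-∃++)
  open import Data.List.Properties using (∷-injectiveʳ; ++-assoc; ʳ++-defn)
  open import Data.List.Relation.Binary.Subset.Propositional using (_⊆_)
  open import Function using (id)
  open import Data.List.Relation.Unary.Any using (here; there)
  open import Data.List.Relation.Unary.Any.Properties using (reverseAcc⁺; reverseAcc⁻)
  open import Data.List.Relation.Unary.All.Properties using (¬Any⇒All¬; All¬⇒¬Any)
  open import Data.List.Relation.Unary.Unique.Propositional using (Unique; []; _∷_)
  open import Data.List.Relation.Unary.Unique.Propositional.Properties using (++⁺)
  open import Data.Product using (Σ; ∃; ∃₂; _×_; _,_; proj₁; proj₂)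
  open import Data.Sum using (_⊎_; inj₁; inj₂; [_,_]′; swap)
  open import Data.Empty using (⊥; ⊥-elim)
  open import Relation.Nullary using (yes; no)
  open import Relation.Unary using (_≐_)
  open import Relation.Binary.PropositionalEquality using (_≡_; _≢_; refl; sym; trans; subst; cong)

  open Graph D S

  module _ {A : Set} where

    Unique-head : ∀ {x : A} {xs} → Unique (x ∷ xs) → x ∉ xs
    Unique-head (x∉xs ∷ _) = All¬⇒¬Any x∉xs

    Unique-tail : ∀ {x : A} {xs} → Unique (x ∷ xs) → Unique xs
    Unique-tail (_ ∷ u) = u

    Unique-∷ : ∀ {x : A} {xs} → x ∉ xs → Unique xs → Unique (x ∷ xs)
    Unique-∷ x∉xs u = ¬Any⇒All¬ _ x∉xs ∷ u

    Unique-++⁻ : ∀ (xs : List A) {ys} → Unique (xs ++ ys) → Unique xs × Unique ys × (∀ {z} → z ∈ xs → z ∉ ys)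
    Unique-++⁻ []       u = [] , u , λ ()
    Unique-++⁻ (x ∷ xs) u with Unique-++⁻ xs (Unique-tail u)
    ... | uxs , uys , disjoint = Unique-∷ (λ x∈xs → Unique-head u (∈-++⁺ˡ x∈xs)) uxs , uys , x∷xs-disjoint
      where
      x∷xs-disjoint : ∀ {z} → z ∈ x ∷ xs → z ∉ _
      x∷xs-disjoint (here refl)  z∈ys = Unique-head u (∈-++⁺ʳ xs z∈ys)
      x∷xs-disjoint (there z∈xs) z∈ys = disjoint z∈xs z∈ys

    Unique-∷ʳ : ∀ {x : A} xs → Unique (x ∷ xs) → Unique (xs ++ x ∷ [])
    Unique-∷ʳ xs u = ++⁺ (Unique-tail u) (Unique-∷ (λ ()) []) λ { (z∈xs , here refl) → Unique-head u z∈xs }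

    Unique-ʳ++ : ∀ (xs : List A) {ys} → Unique xs → Unique ys → (∀ {z} → z ∈ xs → z ∉ ys) → Unique (xs ʳ++ ys)
    Unique-ʳ++ []       _  uys _        = uys
    Unique-ʳ++ (x ∷ xs) ux uys disjoint =
      Unique-ʳ++ xs (Unique-tail ux) (Unique-∷ (disjoint (here refl)) uys) xs-disjoint
      where
      xs-disjoint : ∀ {z} → z ∈ xs → z ∉ x ∷ _
      xs-disjoint z∈xs (here refl)  = Unique-head ux z∈xs
      xs-disjoint z∈xs (there z∈ys) = disjoint (there z∈xs) z∈ys

    ∈-ʳ++⁺ : ∀ {z : A} xs {ys} → z ∈ xs ⊎ z ∈ ys → z ∈ xs ʳ++ ys
    ∈-ʳ++⁺ xs {ys} z∈ = reverseAcc⁺ ys xs (swap z∈)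

    ∈-ʳ++⁻ : ∀ {z : A} xs {ys} → z ∈ xs ʳ++ ys → z ∈ xs ⊎ z ∈ ys
    ∈-ʳ++⁻ xs {ys} z∈ = swap (reverseAcc⁻ ys xs z∈)

  Joins-sym : ∀ {e u v} → Joins e u v → Joins e v u
  Joins-sym (inj₁ xy) = inj₂ xy
  Joins-sym (inj₂ yx) = inj₁ yx

  Joins-endpoints : ∀ {e u v u' v'} → Joins e u v → Joins e u' v' → (u ≡ u' × v ≡ v') ⊎ (u ≡ v' × v ≡ u')
  Joins-endpoints (inj₁ (xu , yv)) (inj₁ (xu' , yv')) = inj₁ (trans (sym xu) xu' , trans (sym yv) yv')
  Joins-endpoints (inj₁ (xu , yv)) (inj₂ (xv' , yu')) = inj₂ (trans (sym xu) xv' , trans (sym yv) yu')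
  Joins-endpoints (inj₂ (xv , yu)) (inj₁ (xu' , yv')) = inj₂ (trans (sym yu) yv' , trans (sym xv) xu')
  Joins-endpoints (inj₂ (xv , yu)) (inj₂ (xv' , yu')) = inj₁ (trans (sym yu) yu' , trans (sym xv) xv')

  Joins⇒≢ : ∀ {e u v} → Joins e u v → u ≢ v
  Joins⇒≢ {e} (inj₁ (xu , yv)) u≡v = x≢y (S e) (trans xu (trans u≡v (sym yv)))
  Joins⇒≢ {e} (inj₂ (xv , yu)) u≡v = x≢y (S e) (trans xv (trans (sym u≡v) (sym yu)))

  Step : Set
  Step = Fin m × Fin n × Fin n

  steps : ∀ {vs es} → Links vs es → List Step
  steps (end _)                     = []
  steps (step {u} {v} {e = e} _ L)  = (e , u , v) ∷ steps L

  ∈-steps⇒Joins : ∀ {vs es} (L : Links vs es) {e w w'} → (e , w , w') ∈ steps L → Joins e w w'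
  ∈-steps⇒Joins (step j L) (here refl) = j
  ∈-steps⇒Joins (step j L) (there st∈) = ∈-steps⇒Joins L st∈

  ∈-steps⇒source∈ : ∀ {vs es} (L : Links vs es) {e w w'} → (e , w , w') ∈ steps L → w ∈ vs
  ∈-steps⇒source∈ (step j L) (here refl) = here refl
  ∈-steps⇒source∈ (step j L) (there st∈) = there (∈-steps⇒source∈ L st∈)

  ∈-steps⇒target∈ : ∀ {vs es} (L : Links vs es) {e w w'} → (e , w , w') ∈ steps L → w' ∈ vs
  ∈-steps⇒target∈ (step j L) (here refl) = there (here refl)
  ∈-steps⇒target∈ (step j L) (there st∈) = there (∈-steps⇒target∈ L st∈)

  ∈-steps⇒edge∈ : ∀ {vs es} (L : Links vs es) {e w w'} → (e , w , w') ∈ steps L → e ∈ es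
  ∈-steps⇒edge∈ (step j L) (here refl) = here refl
  ∈-steps⇒edge∈ (step j L) (there st∈) = there (∈-steps⇒edge∈ L st∈)

  edge∈⇒∈-steps : ∀ {vs es} (L : Links vs es) {e} → e ∈ es → ∃₂ λ w w' → (e , w , w') ∈ steps L
  edge∈⇒∈-steps (step {u} {v} j L) (here refl) = u , v , here refl
  edge∈⇒∈-steps (step j L) (there e∈) with edge∈⇒∈-steps L e∈
  ... | w , w' , st∈ = w , w' , there st∈

  Unique-vertices⇒Unique-edges : ∀ {vs es} → Links vs es → Unique vs → Unique es
  Unique-vertices⇒Unique-edges (end _) _ = []
  Unique-vertices⇒Unique-edges (step {e = e} j L) u = Unique-∷ e∉ (Unique-vertices⇒Unique-edges L (Unique-tail u))
    where
    e∉ : e ∉ _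
    e∉ e∈ with edge∈⇒∈-steps L e∈
    ... | w , w' , st∈ with Joins-endpoints j (∈-steps⇒Joins L st∈)
    ... | inj₁ (refl , _) = Unique-head u (∈-steps⇒source∈ L st∈)
    ... | inj₂ (refl , _) = Unique-head u (∈-steps⇒target∈ L st∈)

  Links-++ : ∀ {u v} xs {ys es fs} → Links (u ∷ xs ++ v ∷ []) es → Links (v ∷ ys) fs →
             Links (u ∷ xs ++ v ∷ ys) (es ++ fs)
  Links-++ []       (step j (end _)) M = step j M
  Links-++ (x ∷ xs) (step j L)       M = step j (Links-++ xs L M)

  Links-∷ʳ : ∀ {u v v' e} xs {es} → Links (u ∷ xs ++ v ∷ []) es → Joins e v v' →
             Links (u ∷ (xs ++ v ∷ []) ++ v' ∷ []) (es ++ e ∷ [])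
  Links-∷ʳ []       (step j (end _)) j' = step j (step j' (end _))
  Links-∷ʳ (x ∷ xs) (step j L)       j' = step j (Links-∷ʳ xs L j')

  steps-∷ʳ : ∀ {u v v' e} xs {es} (L : Links (u ∷ xs ++ v ∷ []) es) (j : Joins e v v') →
             steps (Links-∷ʳ xs L j) ≡ steps L ++ (e , v , v') ∷ []
  steps-∷ʳ []       (step j (end _)) j' = refl
  steps-∷ʳ (x ∷ xs) (step j L)       j' = cong (_ ∷_) (steps-∷ʳ xs L j')

  Links-ʳ++ : ∀ {w v} xs {acc es fs} → Links (w ∷ xs ++ v ∷ []) es → Links (w ∷ acc) fs →
              Links (v ∷ xs ʳ++ w ∷ acc) (es ʳ++ fs)
  Links-ʳ++ []       (step j (end _)) M = step (Joins-sym j) M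
  Links-ʳ++ (x ∷ xs) (step j L)       M = Links-ʳ++ xs L (step (Joins-sym j) M)

  SingleEdge : ∀ {u v} → Path u v → Set
  SingleEdge P = ∃ λ e → edges P ≡ e ∷ []

  ∈-singleton : ∀ {A : Set} {xs : List A} {x y} → xs ≡ y ∷ [] → x ∈ xs → x ≡ y
  ∈-singleton refl (here x≡y) = x≡y

  SingleEdge⇒Joins : ∀ {u v} (P : Path u v) {e} → edges P ≡ e ∷ [] → Joins e u v
  SingleEdge⇒Joins P = go (inner P) (links P)
    where
    go : ∀ {u v} xs {es e} → Links (u ∷ xs ++ v ∷ []) es → es ≡ e ∷ [] → Joins e u v
    go []           (step j (end _))  refl = j
    go (_ ∷ [])     (step _ (step _ _)) ()
    go (_ ∷ _ ∷ _)  (step _ (step _ _)) ()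

  edges≢[] : ∀ {u v} (P : Path u v) → edges P ≢ []
  edges≢[] P = go (inner P) (links P)
    where
    go : ∀ {u v} xs {es} → Links (u ∷ xs ++ v ∷ []) es → es ≢ []
    go []      (step _ _) ()
    go (_ ∷ _) (step _ _) ()

  Unique-edges : ∀ {u v} (P : Path u v) → Unique (edges P)
  Unique-edges P = Unique-vertices⇒Unique-edges (links P) (distinct P)

  first-step : ∀ {w v} xs {es} → Links (w ∷ xs ++ v ∷ []) es →
               ∃₂ λ e w' → Joins e w w' × e ∈ es × w' ∈ xs ++ v ∷ []
  first-step []      (step j _) = _ , _ , j , here refl , here refl
  first-step (_ ∷ _) (step j _) = _ , _ , j , here refl , here refl

  all-edges-join⇒SingleEdge : ∀ {u v u' v'} (P : Path u' v') → (∀ {e} → e ∈ edges P → Joins e u v) → SingleEdge P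
  all-edges-join⇒SingleEdge {u} {v} P = go (inner P) (links P) (distinct P)
    where
    go : ∀ {u' v'} xs {es} → Links (u' ∷ xs ++ v' ∷ []) es → Unique (u' ∷ xs ++ v' ∷ []) →
         (∀ {e} → e ∈ es → Joins e u v) → ∃ λ e → es ≡ e ∷ []
    go []       (step j (end _)) _ _ = _ , refl
    go (i ∷ xs) (step j L) U joins with first-step xs L
    ... | _ , w , j' , e'∈ , w∈ with Joins-endpoints j (joins (here refl)) | Joins-endpoints j' (joins (there e'∈))
    ...   | inj₁ (_ , i≡v)  | inj₁ (i≡u , _)   = ⊥-elim (Joins⇒≢ (joins (here refl)) (trans (sym i≡u) i≡v))
    ...   | inj₂ (_ , i≡u)  | inj₂ (i≡v , _)   = ⊥-elim (Joins⇒≢ (joins (here refl)) (trans (sym i≡u) i≡v))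
    ...   | inj₁ (u'≡u , _) | inj₂ (_ , w≡u)   = ⊥-elim (Unique-head U (there (subst (_∈ _) (trans w≡u (sym u'≡u)) w∈)))
    ...   | inj₂ (u'≡v , _) | inj₁ (_ , w≡v)   = ⊥-elim (Unique-head U (there (subst (_∈ _) (trans w≡v (sym u'≡v)) w∈)))

  AtLeastThree : (Fin m → Set) → Set
  AtLeastThree X = ∀ f g → ∃ λ h → X h × h ≢ f × h ≢ g

  three-distinct⇒AtLeastThree : ∀ {X : Fin m → Set} {h₁ h₂ h₃} → X h₁ → X h₂ → X h₃ →
                                h₁ ≢ h₂ → h₁ ≢ h₃ → h₂ ≢ h₃ → AtLeastThree X
  three-distinct⇒AtLeastThree {h₁ = h₁} {h₂} {h₃} x₁ x₂ x₃ h₁≢h₂ h₁≢h₃ h₂≢h₃ f g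
    with h₁ ≟ f | h₁ ≟ g | h₂ ≟ f | h₂ ≟ g
  ... | no h₁≢f    | no h₁≢g    | _          | _          = h₁ , x₁ , h₁≢f , h₁≢g
  ... | yes _      | _          | no h₂≢f    | no h₂≢g    = h₂ , x₂ , h₂≢f , h₂≢g
  ... | no _       | yes _      | no h₂≢f    | no h₂≢g    = h₂ , x₂ , h₂≢f , h₂≢g
  ... | yes h₁≡f   | _          | yes h₂≡f   | _          = ⊥-elim (h₁≢h₂ (trans h₁≡f (sym h₂≡f)))
  ... | no _       | yes h₁≡g   | _          | yes h₂≡g   = ⊥-elim (h₁≢h₂ (trans h₁≡g (sym h₂≡g)))
  ... | yes h₁≡f   | _          | no _       | yes h₂≡g   =
    h₃ , x₃ , (λ h₃≡f → h₁≢h₃ (trans h₁≡f (sym h₃≡f))) , (λ h₃≡g → h₂≢h₃ (trans h₂≡g (sym h₃≡g)))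
  ... | no _       | yes h₁≡g   | yes h₂≡f   | no _       =
    h₃ , x₃ , (λ h₃≡f → h₂≢h₃ (trans h₂≡f (sym h₃≡f))) , (λ h₃≡g → h₁≢h₃ (trans h₁≡g (sym h₃≡g)))

  singletons⊎AtLeastThree : ∀ (xs ys : List (Fin m)) → Unique xs → Unique ys → (∀ {e} → e ∈ xs → e ∉ ys) →
                            xs ≢ [] → ys ≢ [] →
                            ((∃ λ x → xs ≡ x ∷ []) × (∃ λ y → ys ≡ y ∷ [])) ⊎
                            AtLeastThree (λ e → e ∈ xs ⊎ e ∈ ys)
  singletons⊎AtLeastThree []            _             _  _  _        xs≢[] _     = ⊥-elim (xs≢[] refl)
  singletons⊎AtLeastThree _             []            _  _  _        _     ys≢[] = ⊥-elim (ys≢[] refl)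
  singletons⊎AtLeastThree (x ∷ [])      (y ∷ [])      _  _  _        _     _     = inj₁ ((x , refl) , (y , refl))
  singletons⊎AtLeastThree (x ∷ x' ∷ xs) (y ∷ ys)      ux _  disjoint _     _     =
    inj₂ (three-distinct⇒AtLeastThree (inj₁ (here refl)) (inj₁ (there (here refl))) (inj₂ (here refl))
           (λ x≡x' → Unique-head ux (here x≡x'))
           (λ { refl → disjoint (here refl) (here refl) })
           (λ { refl → disjoint (there (here refl)) (here refl) }))
  singletons⊎AtLeastThree (x ∷ [])      (y ∷ y' ∷ ys) _  uy disjoint _     _     =
    inj₂ (three-distinct⇒AtLeastThree (inj₂ (here refl)) (inj₂ (there (here refl))) (inj₁ (here refl))
           (λ y≡y' → Unique-head uy (here y≡y'))
           (λ { refl → disjoint (here refl) (here refl) })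
           (λ { refl → disjoint (here refl) (there (here refl)) }))

  disjoint-paths⇒SingleEdges⊎AtLeastThree : ∀ {u v} (P Q : Path u v) → (∀ e → e ∈ edges P → e ∈ edges Q → ⊥) →
    (SingleEdge P × SingleEdge Q) ⊎ AtLeastThree (λ e → e ∈ edges P ⊎ e ∈ edges Q)
  disjoint-paths⇒SingleEdges⊎AtLeastThree P Q disjoint =
    singletons⊎AtLeastThree (edges P) (edges Q) (Unique-edges P) (Unique-edges Q) (disjoint _) (edges≢[] P) (edges≢[] Q)

  AtLeastThree-map : ∀ {X Y : Fin m → Set} → (∀ {e} → X e → Y e) → AtLeastThree X → AtLeastThree Y
  AtLeastThree-map X⊆Y three f g with three f g
  ... | h , xh , h≢f , h≢g = h , X⊆Y xh , h≢f , h≢g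

  record RootedCycle : Set where
    field
      {root tip} : Fin n
      rootEdge   : Fin m
      rootJoins  : Joins rootEdge root tip
      returnPath : Path tip root
      rootEdge∉  : rootEdge ∉ edges returnPath

  open RootedCycle public

  cycleEdges : RootedCycle → List (Fin m)
  cycleEdges Z = rootEdge Z ∷ edges (returnPath Z)

  cycleSteps : RootedCycle → List Step
  cycleSteps Z = (rootEdge Z , root Z , tip Z) ∷ steps (links (returnPath Z))

  rootEdgePath : (Z : RootedCycle) → Path (tip Z) (root Z)
  rootEdgePath Z = record
    { inner    = []
    ; edges    = rootEdge Z ∷ []
    ; links    = step (Joins-sym (rootJoins Z)) (end (root Z))
    ; distinct = Unique-∷ (λ { (here tip≡root) → Joins⇒≢ (rootJoins Z) (sym tip≡root) }) (Unique-∷ (λ ()) [])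
    }

  Cycle⇒RootedCycle : (Z : Cycle) → Σ RootedCycle λ R → cycleEdges R ≡ cedges Z
  Cycle⇒RootedCycle Z = go (rest Z) (clinks Z) (cdistinct Z) (edistinct Z)
    where
    go : ∀ {s} rs {es} → Links (s ∷ rs ++ s ∷ []) es → Unique (s ∷ rs) → Unique es →
         Σ RootedCycle λ R → cycleEdges R ≡ es
    go []       (step j (end _)) _ _  = ⊥-elim (Joins⇒≢ j refl)
    go (t ∷ rs) (step j L)       U UE =
      record { rootEdge = _ ; rootJoins = j ; rootEdge∉ = Unique-head UE
             ; returnPath = record { inner = rs ; edges = _ ; links = L ; distinct = Unique-∷ʳ (t ∷ rs) U } } ,
      refl

  rotate′ : ∀ {s t e} → Joins e s t → ∀ rs {es} → Links (t ∷ rs ++ s ∷ []) es → Unique (t ∷ rs ++ s ∷ []) →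
            e ∉ es → RootedCycle
  rotate′ j₀ [] (step j (end _)) U e∉ = record
    { rootEdge = _ ; rootJoins = j ; rootEdge∉ = λ { (here refl) → e∉ (here refl) }
    ; returnPath = record { inner = [] ; edges = _ ; links = step j₀ (end _)
                          ; distinct = Unique-∷ (λ { (here s≡t) → Joins⇒≢ j₀ s≡t }) (Unique-∷ (λ ()) []) } }
  rotate′ {s} j₀ (i ∷ rs) (step {es = es} j L) U e∉ = record
    { rootEdge = _ ; rootJoins = j
    ; rootEdge∉ = λ e∈ → [ Unique-head (Unique-vertices⇒Unique-edges (step j L) U)
                         , (λ { (here refl) → e∉ (here refl) }) ]′ (∈-++⁻ es e∈)
    ; returnPath = record { inner = rs ++ s ∷ [] ; edges = _ ; links = Links-∷ʳ rs L j₀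
                          ; distinct = Unique-∷ʳ (i ∷ rs ++ s ∷ []) U } }

  rotate′-edges : ∀ {s t e} (j₀ : Joins e s t) rs {es} (L : Links (t ∷ rs ++ s ∷ []) es) U e∉ →
                  cycleEdges (rotate′ j₀ rs L U e∉) ≡ es ++ e ∷ []
  rotate′-edges j₀ []       (step j (end _)) U e∉ = refl
  rotate′-edges j₀ (i ∷ rs) (step j L)       U e∉ = refl

  rotate′-steps : ∀ {s t e} (j₀ : Joins e s t) rs {es} (L : Links (t ∷ rs ++ s ∷ []) es) U e∉ →
                  cycleSteps (rotate′ j₀ rs L U e∉) ≡ steps L ++ (e , s , t) ∷ []
  rotate′-steps j₀ []       (step j (end _)) U e∉ = refl
  rotate′-steps j₀ (i ∷ rs) (step j L)       U e∉ = cong (_ ∷_) (steps-∷ʳ rs L j₀)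

  rotate : RootedCycle → RootedCycle
  rotate Z = rotate′ (rootJoins Z) (inner P) (links P) (distinct P) (rootEdge∉ Z)
    where P = returnPath Z

  rotate-edges : ∀ Z → cycleEdges (rotate Z) ≡ edges (returnPath Z) ++ rootEdge Z ∷ []
  rotate-edges Z = rotate′-edges (rootJoins Z) (inner P) (links P) (distinct P) (rootEdge∉ Z)
    where P = returnPath Z

  rotate-steps : ∀ Z → cycleSteps (rotate Z) ≡ steps (links (returnPath Z)) ++ (rootEdge Z , root Z , tip Z) ∷ []
  rotate-steps Z = rotate′-steps (rootJoins Z) (inner P) (links P) (distinct P) (rootEdge∉ Z)
    where P = returnPath Z

  ∈-rotate⁺ : ∀ {A : Set} {z x : A} xs → z ∈ x ∷ xs → z ∈ xs ++ x ∷ []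
  ∈-rotate⁺ xs (here refl) = ∈-++⁺ʳ xs (here refl)
  ∈-rotate⁺ xs (there z∈)  = ∈-++⁺ˡ z∈

  ∈-rotate⁻ : ∀ {A : Set} {z x : A} xs → z ∈ xs ++ x ∷ [] → z ∈ x ∷ xs
  ∈-rotate⁻ xs z∈ = [ there , (λ { (here refl) → here refl }) ]′ (∈-++⁻ xs z∈)

  Rotation : RootedCycle → Fin m → Set
  Rotation Z e = Σ RootedCycle λ Z′ → rootEdge Z′ ≡ e × cycleEdges Z′ ⊆ cycleEdges Z × cycleEdges Z ⊆ cycleEdges Z′ ×
                                      cycleSteps Z ⊆ cycleSteps Z′

  rotate-to : ∀ Z {e} → e ∈ cycleEdges Z → Rotation Z e
  rotate-to Z {e} e∈ with ∈-∃++ e∈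
  ... | pre , post , eq = go Z pre eq
    where
    go : ∀ Z pre {post} → cycleEdges Z ≡ pre ++ e ∷ post → Rotation Z e
    go Z []        refl = Z , refl , id , id , id
    go Z (p ∷ pre) {post} eq with go (rotate Z) pre eq′
      where
      eq′ : cycleEdges (rotate Z) ≡ pre ++ e ∷ post ++ rootEdge Z ∷ []
      eq′ = trans (rotate-edges Z)
              (trans (cong (_++ rootEdge Z ∷ []) (∷-injectiveʳ eq)) (++-assoc pre (e ∷ post) (rootEdge Z ∷ [])))
    ... | Z′ , root≡e , edges⊆ , edges⊇ , steps⊆ =
      Z′ , root≡e ,
      (λ e∈ → ∈-rotate⁻ (edges (returnPath Z)) (subst (_ ∈_) (rotate-edges Z) (edges⊆ e∈))) ,
      (λ e∈ → edges⊇ (subst (_ ∈_) (sym (rotate-edges Z)) (∈-rotate⁺ (edges (returnPath Z)) e∈))) ,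
      (λ st∈ → steps⊆ (subst (_ ∈_) (sym (rotate-steps Z)) (∈-rotate⁺ (steps (links (returnPath Z))) st∈)))

  cycle-of-disjoint-paths : ∀ {u v} (P Q : Path u v) → InternallyDisjoint P Q →
    Σ Cycle λ Z → (∀ {e} → e ∈ cedges Z → E P e ⊎ E Q e) × (∀ {e} → E P e ⊎ E Q e → e ∈ cedges Z)
  cycle-of-disjoint-paths {u} {v} P Q (shared-vertices , shared-edges) = Z , to , from
    where
    Q-inner-split = Unique-++⁻ (inner Q) (Unique-tail (distinct Q))
    back-inner = inner Q ʳ++ []
    back-links : Links (v ∷ inner Q ʳ++ u ∷ []) (edges Q ʳ++ [])
    back-links = Links-ʳ++ (inner Q) (links Q) (end u)
    closing : (inner P ++ v ∷ back-inner) ++ u ∷ [] ≡ inner P ++ v ∷ inner Q ʳ++ u ∷ []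
    closing = trans (++-assoc (inner P) (v ∷ back-inner) (u ∷ []))
                    (cong (λ z → inner P ++ v ∷ z) (sym (ʳ++-defn (inner Q))))
    back-disjoint : ∀ {z} → z ∈ verts P → z ∉ back-inner
    back-disjoint z∈P z∈back with ∈-ʳ++⁻ (inner Q) z∈back
    ... | inj₂ ()
    ... | inj₁ z∈Q with shared-vertices _ z∈P (there (∈-++⁺ˡ z∈Q))
    ...   | inj₁ refl = Unique-head (distinct Q) (∈-++⁺ˡ z∈Q)
    ...   | inj₂ refl = proj₂ (proj₂ Q-inner-split) z∈Q (here refl)
    vertices-unique : Unique (u ∷ inner P ++ v ∷ back-inner)
    vertices-unique = subst Unique (cong (u ∷_) (++-assoc (inner P) (v ∷ []) back-inner))
      (++⁺ (distinct P) (Unique-ʳ++ (inner Q) (proj₁ Q-inner-split) [] (λ _ ()))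
           λ (z∈P , z∈back) → back-disjoint z∈P z∈back)
    edges-unique : Unique (edges P ++ (edges Q ʳ++ []))
    edges-unique = ++⁺ (Unique-edges P) (Unique-ʳ++ (edges Q) (Unique-edges Q) [] (λ _ ()))
      λ (e∈P , e∈back) → [ shared-edges _ e∈P , (λ ()) ]′ (∈-ʳ++⁻ (edges Q) e∈back)
    Z : Cycle
    Z = record
      { start = u ; rest = inner P ++ v ∷ back-inner ; cedges = edges P ++ (edges Q ʳ++ [])
      ; clinks = subst (λ vs → Links (u ∷ vs) _) (sym closing) (Links-++ (inner P) (links P) back-links)
      ; cdistinct = vertices-unique ; edistinct = edges-unique }
    to : ∀ {e} → e ∈ cedges Z → E P e ⊎ E Q e
    to e∈ with ∈-++⁻ (edges P) e∈
    ... | inj₁ e∈P = inj₁ e∈P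
    ... | inj₂ e∈back with ∈-ʳ++⁻ (edges Q) e∈back
    ...   | inj₁ e∈Q = inj₂ e∈Q
    ...   | inj₂ ()
    from : ∀ {e} → E P e ⊎ E Q e → e ∈ cedges Z
    from (inj₁ e∈P) = ∈-++⁺ˡ e∈P
    from (inj₂ e∈Q) = ∈-++⁺ʳ (edges P) (∈-ʳ++⁺ (edges Q) (inj₁ e∈Q))

  ∈-cycleSteps-off-root : ∀ Z {st} → st ∈ cycleSteps Z → proj₁ st ≢ rootEdge Z → st ∈ steps (links (returnPath Z))
  ∈-cycleSteps-off-root Z (here refl)  off = ⊥-elim (off refl)
  ∈-cycleSteps-off-root Z (there st∈)  _   = st∈

  IsCycle-≐ : ∀ {C C′ : EdgeSet} → C ≐ C′ → IsCycle C′ → IsCycle C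
  IsCycle-≐ (C⊆C′ , C′⊆C) (Z , C′≐Z) =
    Z , (λ e∈C → proj₁ C′≐Z (C⊆C′ e∈C)) , (λ e∈Z → C′⊆C (proj₂ C′≐Z e∈Z))

module PathEquations {κ λ′} (D : EuclideanDomain κ λ′) {n m : ℕ} (S : Fin m → Equation D n) where

  open import Data.List using (List; []; _∷_; _++_; map; zipWith)
  open import Data.List.Membership.Propositional using (_∈_; find; lose)
  open import Data.List.Membership.DecPropositional (_≟_ {n}) using (_∈?_)
  open import Data.List.Relation.Unary.Unique.Propositional using (Unique)
  open import Data.List.Relation.Unary.Any using (Any; here; there)
  import Data.List.Relation.Unary.Any.Properties as Any
  open import Data.Product using (∃; ∃₂; _×_; _,_)
  open import Data.Sum as Sum using (_⊎_; inj₁; inj₂; [_,_]′; swap)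
  open import Data.Empty using (⊥-elim)
  open import Relation.Nullary using (¬_; yes; no)
  open import Relation.Binary.PropositionalEquality as ≡ using (_≡_; _≢_; refl)

  open EuclideanDomain D renaming (refl to ≈-refl)
  open import Algebra.Properties.Ring ring using (-‿distribˡ-*)
  open import Relation.Binary.Reasoning.Setoid setoid
  open RingSolver commutativeRing
  import Data.Integer.Base as ℤ
  open Graph D S
  open LinearEquations D
  open Walks D S

  HasZeroCoefficient : Fin m → Set λ′
  HasZeroCoefficient e = a (S e) ≈ 0# ⊎ b (S e) ≈ 0#

  EdgeAnnihilates : (Fin n → Carrier) → Fin m → Set λ′
  EdgeAnnihilates ψ e = a (S e) * ψ (x (S e)) + b (S e) * ψ (y (S e)) ≈ 0#

  orient-cases : ∀ {e w w'} → Joins e w w' →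
    (orient e w ≡ ⟨ a (S e) , b (S e) , c (S e) ⟩ × x (S e) ≡ w × y (S e) ≡ w') ⊎
    (orient e w ≡ ⟨ b (S e) , a (S e) , c (S e) ⟩ × x (S e) ≡ w' × y (S e) ≡ w)
  orient-cases {e} {w} j with x (S e) ≟ w | j
  ... | yes _   | inj₁ xy         = inj₁ (refl , xy)
  ... | yes x≡w | inj₂ (_ , y≡w)  = ⊥-elim (x≢y (S e) (≡.trans x≡w (≡.sym y≡w)))
  ... | no x≢w  | inj₁ (x≡w , _)  = ⊥-elim (x≢w x≡w)
  ... | no _    | inj₂ yx         = inj₂ (refl , yx)

  tc-orient : ∀ e w → tc (orient e w) ≡ c (S e)
  tc-orient e w with x (S e) ≟ w
  ... | yes _ = refl
  ... | no _  = refl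

  orient-lhs : ∀ {e w w'} → Joins e w w' → ∀ (φ : Fin n → Carrier) →
    ta (orient e w) * φ w + tb (orient e w) * φ w' ≈ a (S e) * φ (x (S e)) + b (S e) * φ (y (S e))
  orient-lhs j φ with orient-cases j
  ... | inj₁ (eq , refl , refl) rewrite eq = ≈-refl
  ... | inj₂ (eq , refl , refl) rewrite eq = +-comm _ _

  Satisfies⇒Solves-orient : ∀ {e w w'} φ → Joins e w w' → Satisfies D φ (S e) → Solves (orient e w) (φ w) (φ w')
  Satisfies⇒Solves-orient {e} {w} {w'} φ j sat =
    ≡.subst (ta (orient e w) * φ w + tb (orient e w) * φ w' ≈_) (≡.sym (tc-orient e w)) (trans (orient-lhs j φ) sat)

  EdgeAnnihilates⇒Annihilates-orient : ∀ {e w w'} ψ → Joins e w w' → EdgeAnnihilates ψ e →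
                                      Annihilates (orient e w) (ψ w) (ψ w')
  EdgeAnnihilates⇒Annihilates-orient ψ j h = trans (orient-lhs j ψ) h

  Annihilates-orient⇒EdgeAnnihilates : ∀ {e w w'} ψ → Joins e w w' → Annihilates (orient e w) (ψ w) (ψ w') →
                                      EdgeAnnihilates ψ e
  Annihilates-orient⇒EdgeAnnihilates ψ j h = trans (sym (orient-lhs j ψ)) h

  orient-coefficients : ∀ {e w w'} → Joins e w w' →
    (ta (orient e w) ≡ a (S e) × tb (orient e w) ≡ b (S e)) ⊎ (ta (orient e w) ≡ b (S e) × tb (orient e w) ≡ a (S e))
  orient-coefficients j with orient-cases j
  ... | inj₁ (eq , _) rewrite eq = inj₁ (refl , refl)
  ... | inj₂ (eq , _) rewrite eq = inj₂ (refl , refl)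

  StandingAssumption⇒orient-nondegenerate : ∀ {e w w'} → StandingAssumption D (S e) → Joins e w w' →
                                            ¬ Degenerate (orient e w)
  StandingAssumption⇒orient-nondegenerate (nondeg , _) j (ta≈0 , tb≈0) with orient-coefficients j
  ... | inj₁ (ta≡a , tb≡b) = nondeg (≡.subst (_≈ 0#) ta≡a ta≈0 , ≡.subst (_≈ 0#) tb≡b tb≈0)
  ... | inj₂ (ta≡b , tb≡a) = nondeg (≡.subst (_≈ 0#) tb≡a tb≈0 , ≡.subst (_≈ 0#) ta≡b ta≈0)

  HasZeroCoefficient⇒orient : ∀ {e w w'} → Joins e w w' → HasZeroCoefficient e →
                              ta (orient e w) ≈ 0# ⊎ tb (orient e w) ≈ 0#
  HasZeroCoefficient⇒orient j z with orient-coefficients j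
  ... | inj₁ (ta≡a , tb≡b) = Sum.map (≡.subst (_≈ 0#) (≡.sym ta≡a)) (≡.subst (_≈ 0#) (≡.sym tb≡b)) z
  ... | inj₂ (ta≡b , tb≡a) = Sum.map (≡.subst (_≈ 0#) (≡.sym ta≡b)) (≡.subst (_≈ 0#) (≡.sym tb≡a)) (swap z)

  orient⇒HasZeroCoefficient : ∀ {e w w'} → Joins e w w' → ta (orient e w) ≈ 0# ⊎ tb (orient e w) ≈ 0# →
                              HasZeroCoefficient e
  orient⇒HasZeroCoefficient j z with orient-coefficients j
  ... | inj₁ (ta≡a , tb≡b) = Sum.map (≡.subst (_≈ 0#) ta≡a) (≡.subst (_≈ 0#) tb≡b) z
  ... | inj₂ (ta≡b , tb≡a) = swap (Sum.map (≡.subst (_≈ 0#) ta≡b) (≡.subst (_≈ 0#) tb≡a) z)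

  tb-orient≡ta-orient-reversed : ∀ {e w w'} → Joins e w w' → tb (orient e w) ≡ ta (orient e w')
  tb-orient≡ta-orient-reversed j with orient-cases j | orient-cases (Joins-sym j)
  ... | inj₁ (eq , _) | inj₂ (eq' , _) rewrite eq | eq' = refl
  ... | inj₂ (eq , _) | inj₁ (eq' , _) rewrite eq | eq' = refl
  ... | inj₁ (_ , x≡w , _) | inj₁ (_ , x≡w' , _) = ⊥-elim (Joins⇒≢ j (≡.trans (≡.sym x≡w) x≡w'))
  ... | inj₂ (_ , _ , y≡w) | inj₂ (_ , _ , y≡w') = ⊥-elim (Joins⇒≢ j (≡.trans (≡.sym y≡w) y≡w'))

  orientStep : Step → Triple D
  orientStep (e , w , _) = orient e w

  oriented : ∀ {vs es} → Links vs es → List (Triple D)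
  oriented L = map orientStep (steps L)

  zipWith-orient≡oriented : ∀ {vs es} (L : Links vs es) → zipWith orient es vs ≡ oriented L
  zipWith-orient≡oriented (end _)    = refl
  zipWith-orient≡oriented (step j L) = ≡.cong (_ ∷_) (zipWith-orient≡oriented L)

  impliedBy≡implied-oriented : ∀ {u v} (P : Path u v) → impliedBy P ≡ implied D (oriented (links P))
  impliedBy≡implied-oriented P = ≡.cong (implied D) (zipWith-orient≡oriented (links P))

  oriented≢[] : ∀ {u v} (P : Path u v) → oriented (links P) ≢ []
  oriented≢[] P = go (links P) (edges≢[] P)
    where
    go : ∀ {vs es} (L : Links vs es) → es ≢ [] → oriented L ≢ []
    go (end _)    es≢[] _  = es≢[] refl
    go (step _ _) _     ()

  module _ {ℓ} (R : Triple D → Fin n → Fin n → Set ℓ)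
               (R-combine : ∀ {t t' u w w'} → R t u w → R t' w w' → R (combine D t t') u w') where

    StepsSatisfy : ∀ {vs es} → Links vs es → Set ℓ
    StepsSatisfy L = ∀ {e w w'} → (e , w , w') ∈ steps L → R (orient e w) w w'

    chain-satisfies : ∀ {u w v} xs {es} (L : Links (w ∷ xs ++ v ∷ []) es) {t} → R t u w → StepsSatisfy L →
                      R (chain D t (oriented L)) u v
    chain-satisfies []       (step j (end _)) r rs = R-combine r (rs (here refl))
    chain-satisfies (_ ∷ xs) (step j L)       r rs =
      chain-satisfies xs L (R-combine r (rs (here refl))) (λ st∈ → rs (there st∈))

    impliedBy-satisfies : ∀ {u v} (P : Path u v) → StepsSatisfy (links P) → R (impliedBy P) u v
    impliedBy-satisfies {u} {v} P rs =
      ≡.subst (λ t → R t u v) (≡.sym (impliedBy≡implied-oriented P)) (go (inner P) (links P) rs)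
      where
      go : ∀ xs {es} (L : Links (u ∷ xs ++ v ∷ []) es) → StepsSatisfy L → R (implied D (oriented L)) u v
      go []       (step j (end _)) rs = rs (here refl)
      go (_ ∷ xs) (step j L)       rs = chain-satisfies xs L (rs (here refl)) (λ st∈ → rs (there st∈))

  impliedBy-solves : ∀ {u v} φ (P : Path u v) → (∀ {e} → e ∈ edges P → Satisfies D φ (S e)) →
                     Solves (impliedBy P) (φ u) (φ v)
  impliedBy-solves φ P sat = impliedBy-satisfies (λ t w w' → Solves t (φ w) (φ w')) combine-solves P
    λ st∈ → Satisfies⇒Solves-orient φ (∈-steps⇒Joins (links P) st∈) (sat (∈-steps⇒edge∈ (links P) st∈))

  impliedBy-annihilates : ∀ {u v} ψ (P : Path u v) → (∀ {e} → e ∈ edges P → EdgeAnnihilates ψ e) →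
                          Annihilates (impliedBy P) (ψ u) (ψ v)
  impliedBy-annihilates ψ P ann =
    impliedBy-satisfies (λ t w w' → Annihilates t (ψ w) (ψ w')) (λ {t} {t'} → combine-annihilates {t} {t'}) P
      λ st∈ → EdgeAnnihilates⇒Annihilates-orient ψ (∈-steps⇒Joins (links P) st∈) (ann (∈-steps⇒edge∈ (links P) st∈))

  ta-impliedBy≈0⇒step : ∀ {u v} (P : Path u v) → ta (impliedBy P) ≈ 0# →
                        ∃ λ st → st ∈ steps (links P) × ta (orientStep st) ≈ 0#
  ta-impliedBy≈0⇒step P a≈0 = find (Any.map⁻ {f = orientStep} {P = λ t → ta t ≈ 0#}
    (ta-implied≈0⇒any (oriented (links P)) (oriented≢[] P)
      (≡.subst (λ t → ta t ≈ 0#) (impliedBy≡implied-oriented P) a≈0)))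

  tb-impliedBy≈0⇒step : ∀ {u v} (P : Path u v) → tb (impliedBy P) ≈ 0# →
                        ∃ λ st → st ∈ steps (links P) × tb (orientStep st) ≈ 0#
  tb-impliedBy≈0⇒step P b≈0 = find (Any.map⁻ {f = orientStep} {P = λ t → tb t ≈ 0#}
    (tb-implied≈0⇒any (oriented (links P)) (oriented≢[] P)
      (≡.subst (λ t → tb t ≈ 0#) (impliedBy≡implied-oriented P) b≈0)))

  step⇒ta-impliedBy≈0 : ∀ {u v} (P : Path u v) {st} → st ∈ steps (links P) → ta (orientStep st) ≈ 0# →
                        ta (impliedBy P) ≈ 0#
  step⇒ta-impliedBy≈0 P st∈ a≈0 = ≡.subst (λ t → ta t ≈ 0#) (≡.sym (impliedBy≡implied-oriented P))
    (any⇒ta-implied≈0 (Any.map⁺ {f = orientStep} {P = λ t → ta t ≈ 0#} (lose st∈ a≈0)))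

  step⇒tb-impliedBy≈0 : ∀ {u v} (P : Path u v) {st} → st ∈ steps (links P) → tb (orientStep st) ≈ 0# →
                        tb (impliedBy P) ≈ 0#
  step⇒tb-impliedBy≈0 P st∈ b≈0 = ≡.subst (λ t → tb t ≈ 0#) (≡.sym (impliedBy≡implied-oriented P))
    (any⇒tb-implied≈0 (Any.map⁺ {f = orientStep} {P = λ t → tb t ≈ 0#} (lose st∈ b≈0)))

  StepsAnnihilate : ∀ {vs es} → (Fin n → Carrier) → Links vs es → Set λ′
  StepsAnnihilate φ L = ∀ {e w w'} → (e , w , w') ∈ steps L → Annihilates (orient e w) (φ w) (φ w')

  StepsAnnihilate-scale : ∀ {vs es} {φ : Fin n → Carrier} {L : Links vs es} k →
                          StepsAnnihilate φ L → StepsAnnihilate (λ w → k * φ w) L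
  StepsAnnihilate-scale k annihilate {e} {w} st∈ = Annihilates-scale {orient e w} k (annihilate st∈)

  finish : ∀ {vs es} → Links vs es → Fin n
  finish (end v)    = v
  finish (step _ L) = finish L

  finish∈ : ∀ {w ws es} (L : Links (w ∷ ws) es) → finish L ∈ w ∷ ws
  finish∈ (end _)    = here refl
  finish∈ (step _ L) = there (finish∈ L)

  finish-path : ∀ {u v} xs {es} (L : Links (u ∷ xs ++ v ∷ []) es) → finish L ≡ v
  finish-path []       (step _ (end _)) = refl
  finish-path (_ ∷ xs) (step _ L)       = finish-path xs L

  -- On a walk u₀ … u_k whose i-th step has oriented coefficients (aᵢ , bᵢ), the potential at uᵢ is
  -- (-1)ⁱ a₀⋯aᵢ₋₁ bᵢ⋯b_{k-1}, so that aᵢ π(uᵢ) + bᵢ π(uᵢ₊₁) = 0 for every step; off the walk its value is junk.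
  potential : ∀ {vs es} → Links vs es → Fin n → Carrier
  potential (end _)                w = 1#
  potential (step {u} {e = e} _ L) w with w ≟ u
  ... | yes _ = tb (orient e u) * product (map tb (oriented L))
  ... | no _  = - (ta (orient e u) * potential L w)

  potential-start : ∀ {w ws es} (L : Links (w ∷ ws) es) → potential L w ≡ product (map tb (oriented L))
  potential-start (end _) = refl
  potential-start {w} (step _ _) with w ≟ w
  ... | yes _  = refl
  ... | no w≢w = ⊥-elim (w≢w refl)

  potential-elsewhere : ∀ {u v vs e es w} (j : Joins e u v) (L : Links (v ∷ vs) es) → w ≢ u →
                        potential (step j L) w ≡ - (ta (orient e u) * potential L w)
  potential-elsewhere {u} {w = w} j L w≢u with w ≟ u
  ... | yes w≡u = ⊥-elim (w≢u w≡u)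
  ... | no _    = refl

  potential-annihilates : ∀ {vs es} (L : Links vs es) → Unique vs → StepsAnnihilate (potential L) L
  potential-annihilates (step {u} {v} {e = e} j L) U (here refl) = begin
    ta (orient e u) * potential (step j L) u + tb (orient e u) * potential (step j L) v
      ≡⟨ ≡.cong₂ (λ p q → ta (orient e u) * p + tb (orient e u) * q) (potential-start (step j L))
           (≡.trans (potential-elsewhere j L (λ v≡u → Unique-head U (here (≡.sym v≡u))))
                    (≡.cong (λ p → - (ta (orient e u) * p)) (potential-start L))) ⟩
    ta (orient e u) * (tb (orient e u) * ∏) + tb (orient e u) * - (ta (orient e u) * ∏)
      ≈⟨ cancel (ta (orient e u)) (tb (orient e u)) ∏ ⟩
    0# ∎
    where
    ∏ = product (map tb (oriented L))
    cancel : ∀ a b p → a * (b * p) + b * - (a * p) ≈ 0#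
    cancel = solve 3 (λ a b p → a :* (b :* p) :+ b :* (:- (a :* p)) := con (ℤ.+ 0)) ≈-refl
  potential-annihilates (step {u} {e = e₀} j L) U {e} {w} {w'} (there st∈) =
    Annihilates-cong {orient e w} (rescale w (∈-steps⇒source∈ L st∈)) (rescale w' (∈-steps⇒target∈ L st∈))
      (Annihilates-scale {orient e w} (- ta (orient e₀ u)) (potential-annihilates L (Unique-tail U) st∈))
    where
    rescale : ∀ z → z ∈ _ → - ta (orient e₀ u) * potential L z ≈ potential (step j L) z
    rescale z z∈ = trans (sym (-‿distribˡ-* _ _))
      (≡.subst (- (ta (orient e₀ u) * potential L z) ≈_)
               (≡.sym (potential-elsewhere j L (λ { refl → Unique-head U z∈ }))) ≈-refl)

  potential-finish : ∀ {vs es} (L : Links vs es) → Unique vs →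
                     potential L (finish L) ≈ alternatingSign (oriented L) * product (map ta (oriented L))
  potential-finish (end _)                U = sym (*-identityˡ 1#)
  potential-finish (step {u} {e = e} j L) U = begin
    potential (step j L) (finish L)               ≡⟨ potential-elsewhere j L (λ { refl → Unique-head U (finish∈ L) }) ⟩
    - (ta (orient e u) * potential L (finish L))  ≈⟨ -‿cong (*-congˡ (potential-finish L (Unique-tail U))) ⟩
    - (ta (orient e u) * (alternatingSign (oriented L) * product (map ta (oriented L))))
      ≈⟨ move-sign (ta (orient e u)) (alternatingSign (oriented L)) (product (map ta (oriented L))) ⟩
    - alternatingSign (oriented L) * (ta (orient e u) * product (map ta (oriented L))) ∎
    where
    move-sign : ∀ a s p → - (a * (s * p)) ≈ - s * (a * p)
    move-sign = solve 3 (λ a s p → :- (a :* (s :* p)) := :- s :* (a :* p)) ≈-refl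

  ZeroCoefficientStep : ∀ {vs es} → Links vs es → Set λ′
  ZeroCoefficientStep L = ∃ λ st → st ∈ steps L × (ta (orientStep st) ≈ 0# ⊎ tb (orientStep st) ≈ 0#)

  potential≈0⇒ZeroCoefficientStep : ∀ {vs es} (L : Links vs es) w → potential L w ≈ 0# → ZeroCoefficientStep L
  potential≈0⇒ZeroCoefficientStep (end _)        _ 1≈0 = ⊥-elim (1≉0 1≈0)
  potential≈0⇒ZeroCoefficientStep (step {u} j L) w p≈0 with w ≟ u
  ... | yes _ = [ (λ b≈0 → _ , here refl , inj₂ b≈0) , later ]′ (noZeroDivisors _ _ p≈0)
    where
    later : product (map tb (oriented L)) ≈ 0# → ZeroCoefficientStep (step j L)
    later ∏≈0 with find (Any.map⁻ {f = orientStep} {P = λ t → tb t ≈ 0#} (Any.map⁻ {f = tb} {P = _≈ 0#}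
                           (product≈0⇒any≈0 (map tb (oriented L)) ∏≈0)))
    ... | st , st∈ , b≈0 = st , there st∈ , inj₂ b≈0
  ... | no _  = [ (λ a≈0 → _ , here refl , inj₁ a≈0) , later ]′ (noZeroDivisors _ _ (-x≈0⇒x≈0 p≈0))
    where
    later : potential L w ≈ 0# → ZeroCoefficientStep (step j L)
    later p≈0 with potential≈0⇒ZeroCoefficientStep L w p≈0
    ... | st , st∈ , zero = st , there st∈ , zero

  pathSign : ∀ {u v} → Path u v → Carrier
  pathSign P = alternatingSign (oriented (links P))

  tb-impliedBy≈potential-start : ∀ {u v} (P : Path u v) → tb (impliedBy P) ≈ - (pathSign P * potential (links P) u)
  tb-impliedBy≈potential-start {u} P = begin
    tb (impliedBy P)                        ≡⟨ ≡.cong tb (impliedBy≡implied-oriented P) ⟩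
    tb (implied D (oriented (links P)))     ≈⟨ tb-implied (oriented (links P)) (oriented≢[] P) ⟩
    - (pathSign P * product (map tb (oriented (links P))))
      ≡⟨ ≡.cong (λ p → - (pathSign P * p)) (≡.sym (potential-start (links P))) ⟩
    - (pathSign P * potential (links P) u)  ∎

  potential-end≈ta-impliedBy : ∀ {u v} (P : Path u v) → potential (links P) v ≈ pathSign P * ta (impliedBy P)
  potential-end≈ta-impliedBy {u} {v} P = begin
    potential (links P) v                   ≡⟨ ≡.cong (potential (links P)) (≡.sym (finish-path (inner P) (links P))) ⟩
    potential (links P) (finish (links P))  ≈⟨ potential-finish (links P) (distinct P) ⟩
    pathSign P * product (map ta (oriented (links P))) ≈⟨ *-congˡ (sym (ta-implied (oriented (links P)) (oriented≢[] P))) ⟩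
    pathSign P * ta (implied D (oriented (links P)))
      ≡⟨ ≡.cong (λ t → pathSign P * ta t) (≡.sym (impliedBy≡implied-oriented P)) ⟩
    pathSign P * ta (impliedBy P)           ∎

  glue : ∀ {u v} → Path u v → (Fin n → Carrier) → (Fin n → Carrier) → Fin n → Carrier
  glue P f g w with w ∈? verts P
  ... | yes _ = f w
  ... | no _  = g w

  glue-on : ∀ {u v} (P : Path u v) f g {w} → w ∈ verts P → glue P f g w ≈ f w
  glue-on P f g {w} w∈ with w ∈? verts P
  ... | yes _ = ≈-refl
  ... | no w∉ = ⊥-elim (w∉ w∈)

  glue-off : ∀ {u v} (P : Path u v) f g {w} → (w ∈ verts P → f w ≈ g w) → glue P f g w ≈ g w
  glue-off P f g {w} agree with w ∈? verts P
  ... | yes w∈ = agree w∈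
  ... | no _   = ≈-refl

  glue≈0 : ∀ {u v} (P : Path u v) f g w → glue P f g w ≈ 0# → f w ≈ 0# ⊎ g w ≈ 0#
  glue≈0 P f g w with w ∈? verts P
  ... | yes _ = inj₁
  ... | no _  = inj₂

  glue-annihilates : ∀ {u v u' v'} (P : Path u v) (Q : Path u' v') f g →
                     (∀ {w} → w ∈ verts P → w ∈ verts Q → f w ≈ g w) →
                     StepsAnnihilate f (links P) → StepsAnnihilate g (links Q) →
                     ∀ {e} → E P e ⊎ E Q e → EdgeAnnihilates (glue P f g) e
  glue-annihilates P Q f g agree f-annihilates g-annihilates (inj₁ e∈P) = on-P (edge∈⇒∈-steps (links P) e∈P)
    where
    on-P : ∀ {e} → (∃₂ λ w w' → (e , w , w') ∈ steps (links P)) → EdgeAnnihilates (glue P f g) e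
    on-P (w , w' , st∈) = Annihilates-orient⇒EdgeAnnihilates (glue P f g) (∈-steps⇒Joins (links P) st∈)
      (Annihilates-cong {orient _ w} (sym (glue-on P f g (∈-steps⇒source∈ (links P) st∈)))
                                     (sym (glue-on P f g (∈-steps⇒target∈ (links P) st∈))) (f-annihilates st∈))
  glue-annihilates P Q f g agree f-annihilates g-annihilates (inj₂ e∈Q) = on-Q (edge∈⇒∈-steps (links Q) e∈Q)
    where
    on-Q : ∀ {e} → (∃₂ λ w w' → (e , w , w') ∈ steps (links Q)) → EdgeAnnihilates (glue P f g) e
    on-Q (w , w' , st∈) = Annihilates-orient⇒EdgeAnnihilates (glue P f g) (∈-steps⇒Joins (links Q) st∈)
      (Annihilates-cong {orient _ w} (sym (glue-off P f g (λ w∈P → agree w∈P (∈-steps⇒source∈ (links Q) st∈))))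
                                     (sym (glue-off P f g (λ w∈P → agree w∈P (∈-steps⇒target∈ (links Q) st∈))))
        (g-annihilates st∈))

  SingleEdge⇒impliedBy≡orient : ∀ {u v} (P : Path u v) {e} → edges P ≡ e ∷ [] → impliedBy P ≡ orient e u
  SingleEdge⇒impliedBy≡orient P eq = ≡.cong (λ es → implied D (zipWith orient es (verts P))) eq

  ZeroCoefficientStep⇒zero-edge : ∀ {u v} (P : Path u v) → ZeroCoefficientStep (links P) →
                                  ∃ λ e → E P e × HasZeroCoefficient e
  ZeroCoefficientStep⇒zero-edge P ((e , w , w') , st∈ , zero) =
    e , ∈-steps⇒edge∈ (links P) st∈ , orient⇒HasZeroCoefficient (∈-steps⇒Joins (links P) st∈) zero

module IdentityCycles {κ λ′} (D : EuclideanDomain κ λ′) {n m : ℕ} (S : Fin m → Equation D n)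
  (standing : ∀ e → StandingAssumption D (S e))
  (σ : Fin n → EuclideanDomain.Carrier D) (σ-satisfies : ∀ e → Satisfies D σ (S e)) where

  open import Level using (_⊔_)
  open import Data.List.Membership.Propositional using (_∈_)
  open import Data.List.Relation.Unary.Any using (here; there)
  open import Data.Product using (∃; _×_; _,_; proj₁; proj₂; swap; uncurry)
  open import Data.Sum using (_⊎_; inj₁; inj₂; [_,_]′) renaming (swap to swap⊎)
  open import Data.List.Membership.Propositional.Properties using (∈-++⁺ʳ)
  open import Data.Empty using (⊥; ⊥-elim)
  open import Relation.Nullary using (¬_)
  open import Relation.Unary using (_≐_; _∪_; _⊆_; _⊆′_)
  open import Relation.Binary.PropositionalEquality as ≡ using (_≢_; refl)
  open import Function using (_∘_)

  open EuclideanDomain D renaming (refl to ≈-refl)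
  open import Relation.Binary.Reasoning.Setoid setoid
  open RingSolver commutativeRing
  open Graph D S
  open LinearEquations D
  open Walks D S
  open PathEquations D S

  Identity : EdgeSet → Set (κ ⊔ λ′)
  Identity C = ∀ u v (P Q : Path u v) → E P ⊆′ C → E Q ⊆′ C → EquivEq D (impliedBy P) (impliedBy Q)

  Identity-⊆ : ∀ {C C′ : EdgeSet} → C′ ⊆ C → Identity C → Identity C′
  Identity-⊆ C′⊆C identity u v P Q P⊆C′ Q⊆C′ =
    identity u v P Q (λ e e∈ → C′⊆C (P⊆C′ e e∈)) (λ e e∈ → C′⊆C (Q⊆C′ e e∈))

  impliedBy-solves-σ : ∀ {u v} (P : Path u v) → Solves (impliedBy P) (σ u) (σ v)
  impliedBy-solves-σ P = impliedBy-solves σ P (λ _ → σ-satisfies _)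

  Identity⇒⇛ : ∀ {C} → Identity C → ∀ {u v} (P Q : Path u v) → E P ⊆′ C → E Q ⊆′ C → impliedBy P ⇛ impliedBy Q
  Identity⇒⇛ identity P Q P⊆C Q⊆C p q = proj₁ (identity _ _ P Q P⊆C Q⊆C p q)

  Identity⇒Parallel : ∀ {C} → Identity C → ∀ {u v} (P Q : Path u v) → E P ⊆′ C → E Q ⊆′ C →
                      Parallel (impliedBy P) (impliedBy Q)
  Identity⇒Parallel identity P Q P⊆C Q⊆C = ⇛⇒Parallel {impliedBy P} {impliedBy Q}
    (impliedBy-solves-σ P) (impliedBy-solves-σ Q) (Identity⇒⇛ identity P Q P⊆C Q⊆C)

  SingleEdge⇒nondegenerate : ∀ {u v} (P : Path u v) → SingleEdge P → ¬ Degenerate (impliedBy P)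
  SingleEdge⇒nondegenerate P (e , P≡e) deg =
    StandingAssumption⇒orient-nondegenerate (standing e) (SingleEdge⇒Joins P P≡e)
      (≡.subst Degenerate (SingleEdge⇒impliedBy≡orient P P≡e) deg)

  returnPath⊆ : ∀ Z → E (returnPath Z) ⊆′ (_∈ cycleEdges Z)
  returnPath⊆ Z _ = there

  rootEdgePath⊆ : ∀ Z → E (rootEdgePath Z) ⊆′ (_∈ cycleEdges Z)
  rootEdgePath⊆ Z _ (here refl) = here refl

  returnPath-nondegenerate : ∀ Z → Identity (_∈ cycleEdges Z) → ¬ Degenerate (impliedBy (returnPath Z))
  returnPath-nondegenerate Z identity deg = SingleEdge⇒nondegenerate (rootEdgePath Z) (rootEdge Z , refl)
    (⇛-preserves-Degenerate {impliedBy (returnPath Z)}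
      (impliedBy-solves-σ (returnPath Z)) (impliedBy-solves-σ (rootEdgePath Z))
      (Identity⇒⇛ identity (returnPath Z) (rootEdgePath Z) (returnPath⊆ Z) (rootEdgePath⊆ Z)) deg)

  -- Rooting the cycle at a third edge puts both zero coefficients on the return path, whose implied
  -- equation then degenerates, while the root edge alone implies a nondegenerate equation.
  zero-ta-and-zero-tb⇒⊥ : ∀ Z → Identity (_∈ cycleEdges Z) → AtLeastThree (_∈ cycleEdges Z) →
                          ∀ {stN stF} → stN ∈ cycleSteps Z → stF ∈ cycleSteps Z →
                          ta (orientStep stN) ≈ 0# → tb (orientStep stF) ≈ 0# → ⊥
  zero-ta-and-zero-tb⇒⊥ Z identity three {stN} {stF} N∈ F∈ a≈0 b≈0 = avoiding (three (proj₁ stN) (proj₁ stF))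
    where
    avoiding : (∃ λ h → h ∈ cycleEdges Z × h ≢ proj₁ stN × h ≢ proj₁ stF) → ⊥
    avoiding (h , h∈ , h≢N , h≢F) = rooted (rotate-to Z h∈)
      where
      rooted : Rotation Z h → ⊥
      rooted (Z′ , root≡h , edges⊆ , _ , steps⊆) = returnPath-nondegenerate Z′ (Identity-⊆ edges⊆ identity)
        ( step⇒ta-impliedBy≈0 (returnPath Z′) (off-root N∈ h≢N) a≈0
        , step⇒tb-impliedBy≈0 (returnPath Z′) (off-root F∈ h≢F) b≈0)
        where
        off-root : ∀ {st} → st ∈ cycleSteps Z → h ≢ proj₁ st → st ∈ steps (links (returnPath Z′))
        off-root st∈ h≢ = ∈-cycleSteps-off-root Z′ (steps⊆ st∈) (λ eq → h≢ (≡.trans (≡.sym root≡h) (≡.sym eq)))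

  zero-coefficient-root⇒⊥ : ∀ Z → Identity (_∈ cycleEdges Z) → AtLeastThree (_∈ cycleEdges Z) →
                            HasZeroCoefficient (rootEdge Z) → ⊥
  zero-coefficient-root⇒⊥ Z identity three zero =
    [ ta≈0⇒⊥ , tb≈0⇒⊥ ]′ (HasZeroCoefficient⇒orient (Joins-sym (rootJoins Z)) zero)
    where
    R = returnPath Z
    t = orient (rootEdge Z) (tip Z)
    parallel : Parallel (impliedBy R) t
    parallel = Identity⇒Parallel identity R (rootEdgePath Z) (returnPath⊆ Z) (rootEdgePath⊆ Z)
    t-nondegenerate : ¬ Degenerate t
    t-nondegenerate = SingleEdge⇒nondegenerate (rootEdgePath Z) (rootEdge Z , refl)
    ta≈0⇒⊥ : ta t ≈ 0# → ⊥
    ta≈0⇒⊥ a≈0 = zero-step (ta-impliedBy≈0⇒step R (Parallel⇒ta≈0 {impliedBy R} {t} parallel t-nondegenerate a≈0))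
      where
      zero-step : (∃ λ st → st ∈ steps (links R) × ta (orientStep st) ≈ 0#) → ⊥
      zero-step (_ , N∈ , aN≈0) = zero-ta-and-zero-tb⇒⊥ Z identity three (there N∈) (here refl) aN≈0
        (≡.subst (_≈ 0#) (≡.sym (tb-orient≡ta-orient-reversed (rootJoins Z))) a≈0)
    tb≈0⇒⊥ : tb t ≈ 0# → ⊥
    tb≈0⇒⊥ b≈0 = zero-step (tb-impliedBy≈0⇒step R (Parallel⇒tb≈0 {impliedBy R} {t} parallel t-nondegenerate b≈0))
      where
      zero-step : (∃ λ st → st ∈ steps (links R) × tb (orientStep st) ≈ 0#) → ⊥
      zero-step (_ , F∈ , bF≈0) = zero-ta-and-zero-tb⇒⊥ Z identity three (here refl) (there F∈)
        (≡.subst (_≈ 0#) (tb-orient≡ta-orient-reversed (Joins-sym (rootJoins Z))) b≈0) bF≈0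

  zero-coefficient-edge⇒⊥ : ∀ {C} → IsCycle C → Identity C → AtLeastThree C →
                            ∀ {f} → C f → HasZeroCoefficient f → ⊥
  zero-coefficient-edge⇒⊥ {C} (Z₀ , C≐Z₀) identity three {f} f∈C zero = rooted (rotate-to Z (fromC f∈C))
    where
    Z = proj₁ (Cycle⇒RootedCycle Z₀)
    fromC : ∀ {e} → C e → e ∈ cycleEdges Z
    fromC e∈C = ≡.subst (_ ∈_) (≡.sym (proj₂ (Cycle⇒RootedCycle Z₀))) (proj₁ C≐Z₀ e∈C)
    toC : ∀ {e} → e ∈ cycleEdges Z → C e
    toC e∈ = proj₂ C≐Z₀ (≡.subst (_ ∈_) (proj₂ (Cycle⇒RootedCycle Z₀)) e∈)
    rooted : Rotation Z f → ⊥
    rooted (Z′ , root≡f , edges⊆ , edges⊇ , _) =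
      zero-coefficient-root⇒⊥ Z′ (Identity-⊆ (λ e∈ → toC (edges⊆ e∈)) identity)
        (AtLeastThree-map (λ e∈C → edges⊇ (fromC e∈C)) three) (≡.subst HasZeroCoefficient (≡.sym root≡f) zero)

  module _ {C₁ C₂ : EdgeSet} (cycle₁ : IsCycle C₁) (identity₁ : Identity C₁)
           (cycle₂ : IsCycle C₂) (identity₂ : Identity C₂) {u v} (P₁ P₂ P₃ : Path u v)
           (disjoint₁₂ : InternallyDisjoint P₁ P₂) (disjoint₁₃ : InternallyDisjoint P₁ P₃)
           (C₁≐P₁∪P₂ : C₁ ≐ (E P₁ ∪ E P₂)) (C₂≐P₁∪P₃ : C₂ ≐ (E P₁ ∪ E P₃)) where

    -- Proportionality carries the zero coefficient from P₂ over to P₁, so neither cycle through P₁ can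
    -- have a third edge.
    theta-zero-edge⇒SingleEdges : ∀ {f} → E P₂ f → HasZeroCoefficient f →
                                  SingleEdge P₁ × SingleEdge P₂ × SingleEdge P₃
    theta-zero-edge⇒SingleEdges {f} f∈P₂ zero =
      both-single (singles-in cycle₁ identity₁ P₂ (proj₂ C₁≐P₁∪P₂) (proj₂ disjoint₁₂) (inj₂ f∈P₂) zero)
      where
      singles-in : ∀ {C} → IsCycle C → Identity C → ∀ (Q : Path u v) → E P₁ ∪ E Q ⊆ C →
                   (∀ e → E P₁ e → E Q e → ⊥) → ∀ {g} → (E P₁ ∪ E Q) g → HasZeroCoefficient g →
                   SingleEdge P₁ × SingleEdge Q
      singles-in cycle identity Q P₁∪Q⊆C disjoint g∈ zero-g =
        [ (λ singles → singles)
        , (λ three → ⊥-elim (zero-coefficient-edge⇒⊥ cycle identity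
                               (AtLeastThree-map P₁∪Q⊆C three) (P₁∪Q⊆C g∈) zero-g))
        ]′ (disjoint-paths⇒SingleEdges⊎AtLeastThree P₁ Q disjoint)
      both-single : SingleEdge P₁ × SingleEdge P₂ → SingleEdge P₁ × SingleEdge P₂ × SingleEdge P₃
      both-single ((e₁ , P₁≡e₁) , (e₂ , P₂≡e₂)) =
        (e₁ , P₁≡e₁) , (e₂ , P₂≡e₂) ,
        proj₂ (singles-in cycle₂ identity₂ P₃ (proj₂ C₂≐P₁∪P₃) (proj₂ disjoint₁₃)
                 (inj₁ (≡.subst (e₁ ∈_) (≡.sym P₁≡e₁) (here refl))) zero₁)
        where
        j₁ = SingleEdge⇒Joins P₁ P₁≡e₁
        j₂ = SingleEdge⇒Joins P₂ P₂≡e₂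
        parallel : Parallel (orient e₁ u) (orient e₂ u)
        parallel = ≡.subst₂ Parallel (SingleEdge⇒impliedBy≡orient P₁ P₁≡e₁) (SingleEdge⇒impliedBy≡orient P₂ P₂≡e₂)
          (Identity⇒Parallel identity₁ P₁ P₂ (λ _ → proj₂ C₁≐P₁∪P₂ ∘ inj₁)
                                             (λ _ → proj₂ C₁≐P₁∪P₂ ∘ inj₂))
        nondegenerate₂ : ¬ Degenerate (orient e₂ u)
        nondegenerate₂ = StandingAssumption⇒orient-nondegenerate (standing e₂) j₂
        zero₁ : HasZeroCoefficient e₁
        zero₁ = orient⇒HasZeroCoefficient j₁
          ([ (λ a≈0 → inj₁ (Parallel⇒ta≈0 {orient e₁ u} {orient e₂ u} parallel nondegenerate₂ a≈0))
           , (λ b≈0 → inj₂ (Parallel⇒tb≈0 {orient e₁ u} {orient e₂ u} parallel nondegenerate₂ b≈0))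
           ]′ (HasZeroCoefficient⇒orient j₂ (≡.subst HasZeroCoefficient (∈-singleton P₂≡e₂ f∈P₂) zero)))

  module Theta {C₁ C₂ : EdgeSet} (cycle₁ : IsCycle C₁) (identity₁ : Identity C₁)
               (cycle₂ : IsCycle C₂) (identity₂ : Identity C₂) {u v} (P₁ P₂ P₃ : Path u v)
               (disjoint₁₂ : InternallyDisjoint P₁ P₂) (disjoint₁₃ : InternallyDisjoint P₁ P₃)
               (disjoint₂₃ : InternallyDisjoint P₂ P₃)
               (C₁≐P₁∪P₂ : C₁ ≐ (E P₁ ∪ E P₂)) (C₂≐P₁∪P₃ : C₂ ≐ (E P₁ ∪ E P₃)) where

    C₃ : EdgeSet
    C₃ = E P₂ ∪ E P₃

    zero-edge⇒SingleEdges : ∀ {f} → C₃ f → HasZeroCoefficient f → SingleEdge P₂ × SingleEdge P₃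
    zero-edge⇒SingleEdges (inj₁ f∈P₂) zero = proj₂
      (theta-zero-edge⇒SingleEdges cycle₁ identity₁ cycle₂ identity₂ P₁ P₂ P₃ disjoint₁₂ disjoint₁₃
         C₁≐P₁∪P₂ C₂≐P₁∪P₃ f∈P₂ zero)
    zero-edge⇒SingleEdges (inj₂ f∈P₃) zero = swap (proj₂
      (theta-zero-edge⇒SingleEdges cycle₂ identity₂ cycle₁ identity₁ P₁ P₃ P₂ disjoint₁₃ disjoint₁₂
         C₂≐P₁∪P₃ C₁≐P₁∪P₂ f∈P₃ zero))

    SingleEdges⇒Joins : SingleEdge P₂ → SingleEdge P₃ → ∀ {e} → C₃ e → Joins e u v
    SingleEdges⇒Joins (e₂ , P₂≡e₂) _ (inj₁ e∈P₂) =
      ≡.subst (λ e → Joins e u v) (≡.sym (∈-singleton P₂≡e₂ e∈P₂)) (SingleEdge⇒Joins P₂ P₂≡e₂)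
    SingleEdges⇒Joins _ (e₃ , P₃≡e₃) (inj₂ e∈P₃) =
      ≡.subst (λ e → Joins e u v) (≡.sym (∈-singleton P₃≡e₃ e∈P₃)) (SingleEdge⇒Joins P₃ P₃≡e₃)

    SingleEdges⇒SingleEdge : SingleEdge P₂ → SingleEdge P₃ → ∀ {u' v'} (P : Path u' v') → E P ⊆′ C₃ → SingleEdge P
    SingleEdges⇒SingleEdge single₂ single₃ P P⊆C₃ =
      all-edges-join⇒SingleEdge P (λ e∈ → SingleEdges⇒Joins single₂ single₃ (P⊆C₃ _ e∈))

    zero-potential⇒SingleEdges : ∀ {u' v'} (P : Path u' v') → E P ⊆′ C₃ → ∀ w → potential (links P) w ≈ 0# →
                                 SingleEdge P₂ × SingleEdge P₃
    zero-potential⇒SingleEdges P P⊆C₃ w π≈0 = from-zero-edge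
      (ZeroCoefficientStep⇒zero-edge P (potential≈0⇒ZeroCoefficientStep (links P) w π≈0))
      where
      from-zero-edge : (∃ λ e → E P e × HasZeroCoefficient e) → SingleEdge P₂ × SingleEdge P₃
      from-zero-edge (e , e∈P , zero) = zero-edge⇒SingleEdges (P⊆C₃ e e∈P) zero

    t₂ t₃ : Triple D
    t₂ = impliedBy P₂
    t₃ = impliedBy P₃

    parallel₂₃ : Parallel t₂ t₃
    parallel₂₃ = ⇛⇒Parallel {t₂} {t₃} (impliedBy-solves-σ P₂) (impliedBy-solves-σ P₃) λ p q s →
      Identity⇒⇛ identity₂ P₁ P₃ (λ _ → proj₂ C₂≐P₁∪P₃ ∘ inj₁) (λ _ → proj₂ C₂≐P₁∪P₃ ∘ inj₂) p q
        (Identity⇒⇛ identity₁ P₂ P₁ (λ _ → proj₂ C₁≐P₁∪P₂ ∘ inj₂) (λ _ → proj₂ C₁≐P₁∪P₂ ∘ inj₁)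
           p q s)

    π₂ π₃ : Fin n → Carrier
    π₂ = potential (links P₂)
    π₃ = potential (links P₃)

    potential-start≈ : ∀ (P : Path u v) → potential (links P) u ≈ - (pathSign P * tb (impliedBy P))
    potential-start≈ P = x≈-[s*y]⇒y≈-[s*x] (alternatingSign² (oriented (links P))) (tb-impliedBy≈potential-start P)

    ta-impliedBy≈potential-end : ∀ (P : Path u v) → ta (impliedBy P) ≈ pathSign P * potential (links P) v
    ta-impliedBy≈potential-end P = x≈s*y⇒y≈s*x (alternatingSign² (oriented (links P))) (potential-end≈ta-impliedBy P)

    potentials-cross : π₃ u * π₂ v ≈ π₂ u * π₃ v
    potentials-cross = begin
      π₃ u * π₂ v                            ≈⟨ *-cong (potential-start≈ P₃) (potential-end≈ta-impliedBy P₂) ⟩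
      - (s₃ * tb t₃) * (s₂ * ta t₂)          ≈⟨ regroup s₃ (tb t₃) s₂ (ta t₂) ⟩
      - ((s₂ * s₃) * (ta t₂ * tb t₃))        ≈⟨ -‿cong (*-congˡ parallel₂₃) ⟩
      - ((s₂ * s₃) * (ta t₃ * tb t₂))        ≈⟨ -‿cong (*-congʳ (*-comm s₂ s₃)) ⟩
      - ((s₃ * s₂) * (ta t₃ * tb t₂))        ≈⟨ regroup s₂ (tb t₂) s₃ (ta t₃) ⟨
      - (s₂ * tb t₂) * (s₃ * ta t₃)          ≈⟨ *-cong (potential-start≈ P₂) (potential-end≈ta-impliedBy P₃) ⟨
      π₂ u * π₃ v                            ∎
      where
      s₂ = pathSign P₂
      s₃ = pathSign P₃
      regroup : ∀ s b s′ a → - (s * b) * (s′ * a) ≈ - ((s′ * s) * (a * b))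
      regroup = solve 4 (λ s b s′ a → (:- (s :* b)) :* (s′ :* a) := :- ((s′ :* s) :* (a :* b))) ≈-refl

    -- The potentials of P₂ and P₃, rescaled to agree at u and v, glue to a homogeneous solution on C₃.
    rescaled : Carrier → Carrier → Fin n → Carrier
    rescaled α β = glue P₂ (λ w → α * π₂ w) (λ w → β * π₃ w)

    rescaled-annihilates : ∀ {α β} → α * π₂ u ≈ β * π₃ u → α * π₂ v ≈ β * π₃ v →
                           ∀ {e} → C₃ e → EdgeAnnihilates (rescaled α β) e
    rescaled-annihilates {α} {β} at-u at-v = glue-annihilates P₂ P₃ _ _ agree
      (StepsAnnihilate-scale α (potential-annihilates (links P₂) (distinct P₂)))
      (StepsAnnihilate-scale β (potential-annihilates (links P₃) (distinct P₃)))
      where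
      agree : ∀ {w} → w ∈ verts P₂ → w ∈ verts P₃ → α * π₂ w ≈ β * π₃ w
      agree w∈₂ w∈₃ = [ (λ { refl → at-u }) , (λ { refl → at-v }) ]′ (proj₁ disjoint₂₃ _ w∈₂ w∈₃)

    ψ χ : Fin n → Carrier
    ψ = rescaled (π₃ u) (π₂ u)
    χ = rescaled (π₃ v) (π₂ v)

    ψ-annihilates : ∀ {e} → C₃ e → EdgeAnnihilates ψ e
    ψ-annihilates = rescaled-annihilates (*-comm (π₃ u) (π₂ u)) potentials-cross

    χ-annihilates : ∀ {e} → C₃ e → EdgeAnnihilates χ e
    χ-annihilates = rescaled-annihilates
      (trans (*-comm (π₃ v) (π₂ u)) (trans (sym potentials-cross) (*-comm (π₃ u) (π₂ v))))
      (*-comm (π₃ v) (π₂ v))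

    C₃-path-nondegenerate : ∀ {u' v'} (P : Path u' v') → E P ⊆′ C₃ → ¬ Degenerate (impliedBy P)
    C₃-path-nondegenerate P P⊆C₃ deg = from-zero-step (ta-impliedBy≈0⇒step P (proj₁ deg))
      where
      from-zero-step : (∃ λ st → st ∈ steps (links P) × ta (orientStep st) ≈ 0#) → ⊥
      from-zero-step (st , st∈ , a≈0) = from-zero-edge (ZeroCoefficientStep⇒zero-edge P (st , st∈ , inj₁ a≈0))
        where
        from-zero-edge : (∃ λ e → E P e × HasZeroCoefficient e) → ⊥
        from-zero-edge (e , e∈P , zero) = SingleEdge⇒nondegenerate P
          (uncurry SingleEdges⇒SingleEdge (zero-edge⇒SingleEdges (P⊆C₃ e e∈P) zero) P P⊆C₃) deg

    ψu≈0∧χv≈0⇒⊥ : SingleEdge P₂ → SingleEdge P₃ → ψ u ≈ 0# → χ v ≈ 0# → ⊥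
    ψu≈0∧χv≈0⇒⊥ single₂ single₃ ψu≈0 χv≈0 =
      Parallel-zeros⇒⊥ {t₂} {t₃} parallel₂₃
        (SingleEdge⇒nondegenerate P₂ single₂) (SingleEdge⇒nondegenerate P₃ single₃)
        (swap⊎ ([ (λ z → inj₁ (tb≈0 P₃ z)) , (λ z → inj₂ (tb≈0 P₂ z)) ]′
                  (noZeroDivisors _ _ (trans (sym (glue-on P₂ _ _ (here refl))) ψu≈0))))
        (swap⊎ ([ (λ z → inj₁ (ta≈0 P₃ z)) , (λ z → inj₂ (ta≈0 P₂ z)) ]′
                  (noZeroDivisors _ _ (trans (sym (glue-on P₂ _ _ (there (∈-++⁺ʳ (inner P₂) (here refl))))) χv≈0))))
      where
      tb≈0 : ∀ P → potential (links P) u ≈ 0# → tb (impliedBy P) ≈ 0#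
      tb≈0 P z = trans (tb-impliedBy≈potential-start P) (x≈0⇒-x≈0 (y≈0⇒x*y≈0 (pathSign P) z))
      ta≈0 : ∀ P → potential (links P) v ≈ 0# → ta (impliedBy P) ≈ 0#
      ta≈0 P z = trans (ta-impliedBy≈potential-end P) (y≈0⇒x*y≈0 (pathSign P) z)

    C₃-path-potentials≉0 : ∀ {u' v'} (P : Path u' v') → E P ⊆′ C₃ →
                           ¬ (ψ u' ≈ 0# × ψ v' ≈ 0# × χ u' ≈ 0# × χ v' ≈ 0#)
    C₃-path-potentials≉0 {u'} {v'} P P⊆C₃ (ψu'≈0 , ψv'≈0 , χu'≈0 , χv'≈0) =
      with-singles ([ [ (λ z → zero-potential⇒SingleEdges P₃ (λ _ → inj₂) u z)
                      , (λ z → zero-potential⇒SingleEdges P₂ (λ _ → inj₁) u' z) ]′ ∘ noZeroDivisors _ _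
                    , [ (λ z → zero-potential⇒SingleEdges P₂ (λ _ → inj₁) u z)
                      , (λ z → zero-potential⇒SingleEdges P₃ (λ _ → inj₂) u' z) ]′ ∘ noZeroDivisors _ _
                    ]′ (glue≈0 P₂ _ _ u' ψu'≈0))
      where
      with-singles : SingleEdge P₂ × SingleEdge P₃ → ⊥
      with-singles (single₂ , single₃) with SingleEdges⇒SingleEdge single₂ single₃ P P⊆C₃
      ... | e , P≡e with Joins-endpoints
        (SingleEdges⇒Joins single₂ single₃ (P⊆C₃ e (≡.subst (e ∈_) (≡.sym P≡e) (here refl)))) (SingleEdge⇒Joins P P≡e)
      ...   | inj₁ (refl , refl) = ψu≈0∧χv≈0⇒⊥ single₂ single₃ ψu'≈0 χv'≈0
      ...   | inj₂ (refl , refl) = ψu≈0∧χv≈0⇒⊥ single₂ single₃ ψv'≈0 χu'≈0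

    C₃-identity : Identity C₃
    C₃-identity u' v' P Q P⊆C₃ Q⊆C₃ p q = implies P Q P⊆C₃ Q⊆C₃ p q , implies Q P Q⊆C₃ P⊆C₃ p q
      where
      annihilates : ∀ {φ} → (∀ {e} → C₃ e → EdgeAnnihilates φ e) → (P : Path u' v') → E P ⊆′ C₃ →
                    Annihilates (impliedBy P) (φ u') (φ v')
      annihilates {φ} φ-annihilates P P⊆C₃ = impliedBy-annihilates φ P (λ e∈ → φ-annihilates (P⊆C₃ _ e∈))
      implies : ∀ (P Q : Path u' v') → E P ⊆′ C₃ → E Q ⊆′ C₃ → impliedBy P ⇛ impliedBy Q
      implies P Q P⊆C₃ Q⊆C₃ = common-solutions⇒⇛ {impliedBy P} {impliedBy Q}
        (impliedBy-solves-σ P) (impliedBy-solves-σ Q)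
        (annihilates ψ-annihilates P P⊆C₃) (annihilates ψ-annihilates Q Q⊆C₃)
        (annihilates χ-annihilates P P⊆C₃) (annihilates χ-annihilates Q Q⊆C₃)
        (C₃-path-potentials≉0 P P⊆C₃) (C₃-path-nondegenerate P P⊆C₃)

    C₃-cycle : IsCycle C₃
    C₃-cycle with cycle-of-disjoint-paths P₂ P₃ disjoint₂₃
    ... | Z , to , from = Z , from , to

  theta-third-IdentityCycle : ∀ C₁ C₂ C₃ → IdentityCycle C₁ → IdentityCycle C₂ → ThetaThird C₁ C₂ C₃ →
                              IdentityCycle C₃
  theta-third-IdentityCycle C₁ C₂ C₃ (cycle₁ , _ , identity₁) (cycle₂ , _ , identity₂)
                            (u , v , P₁ , P₂ , P₃ , d₁₂ , d₁₃ , d₂₃ , C₁≐ , C₂≐ , C₃≐) =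
    IsCycle-≐ C₃≐ C₃-cycle , (σ , λ e _ → σ-satisfies e) , Identity-⊆ (proj₁ C₃≐) C₃-identity
    where open Theta cycle₁ identity₁ cycle₂ identity₂ P₁ P₂ P₃ d₁₂ d₁₃ d₂₃ C₁≐ C₂≐

mainTheorem14 : ∀ {c ℓ} (D : EuclideanDomain c ℓ) {n m : _} (S : Fin m → Equation D n) →
    (∀ e → StandingAssumption D (S e)) →
    Consistent D S →
    Graph.IsBiasedGraph D S (Graph.IdentityCycle D S)
mainTheorem14 D S standing (σ , σ-satisfies) = (λ _ identityCycle → proj₁ identityCycle) , theta-third-IdentityCycle
  where open IdentityCycles D S standing σ σ-satisfies
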